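{- A dessin $\mathcal D\in GP(n,p,c)$ is kaleidoscopic if and only if $n=3$, $p\equiv2\pmod3$ and $c=1$.
   Context: A regular dessin is determined up to isomorphism by a triple $(G;x,y)$ with $G$ a finite group generated by $x,y$; $(G;x,y)$ and $(G';x',y')$ give isomorphic dessins iff some isomorphism $G\to G'$ sends $x\mapsto x'$, $y\mapsto y'$. Put $z=(xy)^{ -1}$. The group $\Omega\cong S_3$ consists of the identity and the operations $\mathcal D^{01}=(G;y,x)$, $\mathcal D^{12}=(G;x,z)$, $\mathcal D^{02}=(G;z,y)$, $\mathcal D^{012}=(G;y,z)$, $\mathcal D^{210}=(G;z,x)$. The operation $H_{ -1}$ sends $(G;x,y)$ to its mirror image $(G;x^{ -1},y^{ -1})$, and $\Omega^*=\langle\Omega,H_{ -1}\rangle$ consists of the twelve operations $\omega$, $H_{ -1}\circ\omega$ ($\omega\in\Omega$). Generalised Paley dessins: let $p$ be prime, $d\ge1$, $q=p^d$. Let ${\rm AGL}_1(q)$ be the group of maps $t\mapsto at+b$ of ${\mathbb F}_q$ ($a\ne0$), $T=\{t\mapsto t+b\}$. For a subgroup $S\le{\mathbb F}_q^*$ of order $n$ (identified with $\{t\mapsto at:a\in S\}$), $G_S=T\rtimes S$, where either $n=d=1$, or $n>1$ and $p$ has multiplicative order $d$ mod $n$. For $x$ a generator of $S$ and $y\in G_S\setminus S$, the regular dessin $(G_S;x,y)$ is a generalised Paley dessin with valency $n$ and characteristic $p$; its colour constant is the unique $c\in{\mathbb Z}_n$ with $y\in Tx^c$. $GP(n,p,c)$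 is the set of isomorphism classes of these with colour constant $c$. Hole operations: for $j$ coprime to $n$ and $\mathcal D=(G;x,y)\in GP(n,p,c)$ with $c\ne0$, $H_j(\mathcal D)=(G;x^j,y^j)$; for $c=0$ one uses $D^{12}\circ H_j\circ D^{12}$. A dessin $\mathcal D\in GP(n,p,c)$ is kaleidoscopic if it is invariant up to isomorphism under all operations in $\Omega^*$ and all hole operations $H_j$, $j\in{\mathbb Z}_n^*$. -}

module Defs where

open import Data.Nat using (ℕ; zero; suc; _^_; _∸_; _≤_; _<_)
open import Data.Nat.Divisibility using (_∣_)
open import Data.Nat.Coprimality using (Coprime)
open import Data.Product using (Σ; ∃; _×_; _,_; proj₁; proj₂)
open import Data.Sum using (_⊎_)
open import Data.Bool using (Bool; true; false)
open import Data.List using (List; length)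
open import Data.List.Membership.Propositional using (_∈_)
open import Data.List.Relation.Unary.Unique.Propositional using (Unique)
open import Relation.Binary.PropositionalEquality using (_≡_; _≢_)
open import Relation.Nullary using (¬_)
open import Algebra.Structures using (IsCommutativeRing)

MultOrder : ℕ → ℕ → ℕ → Set
MultOrder p n d =
  (1 ≤ d) × (n ∣ (p ^ d ∸ 1)) × (∀ k → 1 ≤ k → k < d → ¬ (n ∣ (p ^ k ∸ 1)))

ValencyCond : ℕ → ℕ → ℕ → Set
ValencyCond n p d = (n ≡ 1 × d ≡ 1) ⊎ ((1 < n) × MultOrder p n d)

record FiniteField : Set₁ where
  infixl 6 _+_
  infixl 7 _*_
  field
    Carrier : Set
    _+_ _*_ : Carrier → Carrier → Carrier
    -_ : Carrier → Carrier
    0# 1# : Carrier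
    _⁻¹ : Carrier → Carrier
    isCommutativeRing : IsCommutativeRing _≡_ _+_ _*_ -_ 0# 1#
    0≢1 : 0# ≢ 1#
    ⁻¹-inverse : ∀ a → a ≢ 0# → a * (a ⁻¹) ≡ 1#
    elements : List Carrier
    elements-unique : Unique elements
    elements-complete : ∀ a → a ∈ elements

  size : ℕ
  size = length elements

  pow : Carrier → ℕ → Carrier
  pow a zero = 1#
  pow a (suc k) = a * pow a k

record MultSubgroup (F : FiniteField) (n : ℕ) : Set where
  open FiniteField F
  field
    elems : List Carrier
    elems-unique : Unique elems
    elems-order : length elems ≡ n
    elems-nonzero : ∀ a → a ∈ elems → a ≢ 0#
    one∈ : 1# ∈ elems
    mul∈ : ∀ a b → a ∈ elems → b ∈ elems → (a * b) ∈ elems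
    inv∈ : ∀ a → a ∈ elems → (a ⁻¹) ∈ elems

-- AGL_1(F): the pair (a , b) stands for the map t ↦ a t + b.
-- Product is composition: (g · h)(t) = g (h t).

module AGL (F : FiniteField) where
  open FiniteField F

  Aff : Set
  Aff = Carrier × Carrier

  _·_ : Aff → Aff → Aff
  (a , b) · (a' , b') = (a * a' , a * b' + b)

  e : Aff
  e = (1# , 0#)

  inv : Aff → Aff
  inv (a , b) = (a ⁻¹ , - (a ⁻¹ * b))

  _^ᵍ_ : Aff → ℕ → Aff
  g ^ᵍ zero = e
  g ^ᵍ suc k = g · (g ^ᵍ k)

  -- a dessin on the fixed group: the generating pair (x , y)
  Pair : Set
  Pair = Aff × Aff

  zOf : Pair → Aff
  zOf (x , y) = inv (x · y)

  data Ω : Set where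
    Id D01 D12 D02 D012 D210 : Ω

  applyΩ : Ω → Pair → Pair
  applyΩ Id   (x , y) = (x , y)
  applyΩ D01  (x , y) = (y , x)
  applyΩ D12  (x , y) = (x , zOf (x , y))
  applyΩ D02  (x , y) = (zOf (x , y) , y)
  applyΩ D012 (x , y) = (y , zOf (x , y))
  applyΩ D210 (x , y) = (zOf (x , y) , x)

  mirror : Pair → Pair
  mirror (x , y) = (inv x , inv y)

  -- Ω* = Ω ∪ H₋₁ ∘ Ω ; the Bool records whether H₋₁ is applied after ω
  applyΩ* : Ω × Bool → Pair → Pair
  applyΩ* (ω , false) D = applyΩ ω D
  applyΩ* (ω , true)  D = mirror (applyΩ ω D)

  Hraw : ℕ → Pair → Pair
  Hraw j (x , y) = (x ^ᵍ j , y ^ᵍ j)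

  holeOp : ℕ → ℕ → Pair → Pair
  holeOp j zero    D = applyΩ D12 (Hraw j (applyΩ D12 D))
  holeOp j (suc _) D = Hraw j D

  module _ {n : ℕ} (S : MultSubgroup F n) where
    open MultSubgroup S

    InG : Aff → Set
    InG (a , b) = a ∈ elems

    InS : Aff → Set
    InS g = Σ Carrier λ a → (a ∈ elems) × (g ≡ (a , 0#))

    record Automorphism : Set where
      field
        φ : Aff → Aff
        φ-closed : ∀ g → InG g → InG (φ g)
        φ-hom : ∀ g h → InG g → InG h → φ (g · h) ≡ φ g · φ h
        φ-inj : ∀ g h → InG g → InG h → φ g ≡ φ h → g ≡ h
        φ-surj : ∀ g → InG g → Σ Aff λ h → InG h × (φ h ≡ g)

    IsoDessin : Pair → Pair → Set
    IsoDessin (x , y) (x' , y') =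
      Σ Automorphism λ A → (Automorphism.φ A x ≡ x') × (Automorphism.φ A y ≡ y')

    Kaleidoscopic : ℕ → Pair → Set
    Kaleidoscopic c D =
      (∀ (ω : Ω × Bool) → IsoDessin D (applyΩ* ω D)) ×
      (∀ (j : ℕ) → Coprime j n → IsoDessin D (holeOp j c D))

{-# OPTIONS --safe #-}
-- Write x = (g, 0) and y = (gᶜ, b), b ≠ 0, in G_S = T ⋊ S. Every translation is a commutator (as
-- g ≠ 1), so for any automorphism φ of G_S the linear part of φ(u) depends only on that of u; since
-- y ≡ xᶜ modulo T, φ(y) has linear part (that of φ(x))ᶜ. Invariance under D¹² and D⁰¹ then gives
-- n ∣ 2c + 1 and n ∣ c² − 1, which forces n = 3 and c = 1. As 3 ∣ pᵈ − 1, p ≢ 0 (mod 3); and p ≡ 1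
-- would give d = 1, but over the prime field the linear part of every automorphism fixes g, so H₂
-- (x ↦ x²) cannot be realised. Conversely, for n = 3, p ≡ 2 (mod 3) and c = 1, every operation in
-- Ω* and every H_j sends (x, y) to a pair whose entries share the linear part g (ω ∈ Ω, j ≡ 1) or
-- g² (mirrored ω, j ≡ 2) and have distinct translation parts, because 1 + g + g² = 0. Such a pair
-- is the image of (x, y) under "apply σ to the coefficients, then conjugate by t ↦ l t + μ" for
-- suitable l and μ, where σ is the identity or the Frobenius t ↦ tᵖ, which maps g to g².
module Submission where

open import Defs
open import Data.Nat using (ℕ; _^_; _≤_; _%_)
open import Data.Nat.Primality using (Prime)
open import Data.Fin using (Fin; toℕ)
open import Data.Product using (Σ; _×_; _,_; proj₁)
open import Function.Bundles using (_⇔_)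
open import Relation.Binary.PropositionalEquality using (_≡_)
open import Relation.Nullary using (¬_)
open import Data.List.Membership.Propositional using (_∈_)

open import Algebra.Bundles using (CommutativeRing)
open import Algebra.Solver.Ring.AlmostCommutativeRing using (fromCommutativeRing; _-Raw-AlmostCommutative⟶_)
open import Data.Bool using (true; false)
open import Data.Empty using (⊥-elim)
open import Data.Fin as Fin using (zero; suc)
import Data.Fin.Properties as Fin
open import Data.Fin.Permutation using (Permutation′; permutation)
open import Data.Integer as ℤ using (ℤ; -[1+_]; _⊖_; _◃_; sign; ∣_∣)
import Data.Integer.Properties as ℤ
open import Data.List using (List; _∷_; length; lookup)
import Data.List.Relation.Unary.All as All
open import Data.List.Membership.Propositional.Properties using (∈-lookup)
open import Data.List.Relation.Unary.AllPairs using (_∷_)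
open import Data.List.Relation.Unary.Any using (index)
open import Data.List.Relation.Unary.Any.Properties using (lookup-index)
open import Data.List.Relation.Unary.Unique.Propositional using (Unique)
open import Data.Maybe as Maybe using (Maybe)
open import Data.Nat as ℕ using (zero; suc)
import Data.Nat.Properties as ℕ
open import Data.Nat.Combinatorics using (_C_; nCn≡1)
open import Data.Nat.Coprimality using (Coprime; coprime?; coprime-Bézout; prime⇒coprime)
open import Data.Nat.Divisibility using (_∣_; divides; m%n≡0⇒n∣m)
open import Data.Nat.DivMod using (_/_; m≡m%n+[m/n]*n; m%n<n)
open import Data.Nat.GCD using (module Bézout)
open import Data.Nat.Primality using (prime⇒nonZero)
open import Data.Product using (∃; proj₂)
open import Data.Sign as Sign using (Sign)
open import Data.Sum using (_⊎_; inj₁; inj₂)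
open import Function using (_∘_)
open import Function.Bundles using (mk⇔)
open import Function.Definitions using (Injective)
open import Relation.Binary.Definitions using (tri<; tri≈; tri>)
open import Relation.Binary.PropositionalEquality
open import Relation.Nullary using (yes; no; Dec)
open import Relation.Nullary.Decidable using (dec⇒maybe; from-yes)

module Arithmetic where
  open import Data.Nat
  open import Data.Nat.Properties
  open import Data.Nat.Divisibility
  open import Data.Nat.Primality using (Prime; euclidsLemma; prime⇒nonTrivial)
  open import Data.Nat.Combinatorics using (_C_; nCk≡n!/k![n-k]!; k![n∸k]!∣n!)
  open import Data.Nat.Coprimality using (Coprime)
  open import Data.Nat.DivMod using (_%_; _/_; m/n*n≡m; m≡m%n+[m/n]*n; m%n<n)
  open import Data.Nat.Solver using (module +-*-Solver)
  open import Data.Product using (_×_; _,_)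
  open import Data.Sum using (_⊎_; inj₁; inj₂)
  open import Data.Empty using (⊥-elim)
  open import Relation.Nullary using (¬_; contradiction)
  open import Relation.Binary.PropositionalEquality

  prime∤! : ∀ {p} → Prime p → ∀ m → m < p → ¬ p ∣ m !
  prime∤! p-prime zero    _   p∣1 = nonTrivial⇒≢1 {{prime⇒nonTrivial p-prime}} (∣1⇒≡1 p∣1)
  prime∤! p-prime (suc m) m<p p∣m! with euclidsLemma (suc m) (m !) p-prime p∣m!
  ... | inj₁ p∣m+1 = <⇒≱ m<p (∣⇒≤ p∣m+1)
  ... | inj₂ p∣m!  = prime∤! p-prime m (<-trans (n<1+n m) m<p) p∣m!

  n∣n! : ∀ n .{{_ : NonZero n}} → n ∣ n !
  n∣n! (suc n) = m∣m*n (n !)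

  prime∣choose : ∀ {p k} → Prime p → 0 < k → k < p → p ∣ p C k
  prime∣choose {p} {k} p-prime 0<k k<p
    with euclidsLemma (p C k) (k ! * (p ∸ k) !) p-prime p∣product
    where
    instance
      _ : NonZero (k ! * (p ∸ k) !)
      _ = m*n≢0 (k !) ((p ∸ k) !) {{k !≢0}} {{(p ∸ k) !≢0}}
    p∣product : p ∣ (p C k) * (k ! * (p ∸ k) !)
    p∣product = subst (p ∣_)
      (sym (trans (cong (_* (k ! * (p ∸ k) !)) (nCk≡n!/k![n-k]! (<⇒≤ k<p))) (m/n*n≡m (k![n∸k]!∣n! (<⇒≤ k<p)))))
      (n∣n! p {{nonTrivial⇒nonZero p {{prime⇒nonTrivial p-prime}}}})
  ... | inj₁ p∣C = p∣C
  ... | inj₂ p∣k!*[p-k]! with euclidsLemma (k !) ((p ∸ k) !) p-prime p∣k!*[p-k]!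
  ...   | inj₁ p∣k!     = ⊥-elim (prime∤! p-prime k k<p p∣k!)
  ...   | inj₂ p∣[p-k]! = ⊥-elim (prime∤! p-prime (p ∸ k) (∸-monoʳ-< 0<k (<⇒≤ k<p)) p∣[p-k]!)

  private
    divisor-equals-odd : ∀ {n c} → c < n → n ∣ suc (c + c) → n ≡ suc (c + c)
    divisor-equals-odd c<n (divides zero ())
    divisor-equals-odd {n} {c} c<n (divides (suc zero) eq) = trans (sym (+-identityʳ n)) (sym eq)
    divisor-equals-odd {n} {c} c<n (divides (suc (suc k)) eq) =
      contradiction (≤-reflexive (sym eq)) (<⇒≱ (begin-strict
        suc (c + c)       ≤⟨ +-monoˡ-< c c<n ⟩
        n + c             <⟨ +-monoʳ-< n c<n ⟩
        n + n             ≤⟨ m≤m+n (n + n) (k * n) ⟩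
        n + n + k * n     ≡⟨ +-assoc n n (k * n) ⟩
        suc (suc k) * n   ∎))
      where open ≤-Reasoning

  valency-three : ∀ {n c} → 1 < n → c < n → n ∣ suc (c + c) → n ∣ ∣ c * c - 1 ∣ → n ≡ 3 × c ≡ 1
  valency-three {n} {zero}  1<n _   n∣1   _       = contradiction (∣1⇒≡1 n∣1) (>⇒≢ 1<n)
  valency-three {n} {suc c} 1<n c<n n∣odd n∣c²-1 = trans n≡odd (cong (λ c → 3 + (c + c)) c≡0) , cong suc c≡0
    where
    open +-*-Solver
    n≡odd : n ≡ 3 + (c + c)
    n≡odd = trans (divisor-equals-odd c<n n∣odd) (cong (2 +_) (+-suc c c))
    factorisation : (3 + (c + c)) * suc (c + c) ≡ 4 * (c + c * suc c) + 3
    factorisation = solve 1 (λ c → (con 3 :+ (c :+ c)) :* (con 1 :+ (c :+ c))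
                                 := con 4 :* (c :+ c :* (con 1 :+ c)) :+ con 3) refl c
    n∣3 : n ∣ 3
    n∣3 = ∣m+n∣m⇒∣n (subst (n ∣_) (trans (cong (_* suc (c + c)) n≡odd) factorisation) (m∣m*n (suc (c + c))))
                     (∣n⇒∣m*n 4 (subst (n ∣_) (m≤n⇒∣n-m∣≡n∸m {n = c + c * suc c} z≤n) n∣c²-1))
    c≡0 : c ≡ 0
    c≡0 = m+n≡0⇒m≡0 c (n≤0⇒n≡0 (+-cancelˡ-≤ 3 (c + c) 0 (subst (_≤ 3) n≡odd (∣⇒≤ n∣3))))

  ∣n∧∣n^[1+k]∸1⇒≡1 : ∀ {d n} k .{{_ : NonZero n}} → d ∣ n → d ∣ n ^ suc k ∸ 1 → d ≡ 1
  ∣n∧∣n^[1+k]∸1⇒≡1 {d} {n} k d∣n d∣n^[1+k]∸1 = ∣1⇒≡1 (∣m+n∣m⇒∣n d∣n^[1+k] d∣n^[1+k]∸1)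
    where
    d∣n^[1+k] : d ∣ n ^ suc k ∸ 1 + 1
    d∣n^[1+k] = subst (d ∣_) (sym (m∸n+n≡m (m^n>0 n (suc k)))) (∣m⇒∣m*n (n ^ k) d∣n)

  %≡1⇒∣∸1 : ∀ m n .{{_ : NonZero n}} → m % n ≡ 1 → n ∣ m ∸ 1
  %≡1⇒∣∸1 m n m%n≡1 = divides (m / n) (begin
    m ∸ 1                 ≡⟨ cong (_∸ 1) (m≡m%n+[m/n]*n m n) ⟩
    m % n + m / n * n ∸ 1 ≡⟨ cong (λ r → r + m / n * n ∸ 1) m%n≡1 ⟩
    1 + m / n * n ∸ 1     ≡⟨ m+n∸m≡n 1 (m / n * n) ⟩
    m / n * n             ∎)
    where open ≡-Reasoning

  multOrder≡1 : ∀ {p n d} → MultOrder p n d → n ∣ p ∸ 1 → d ≡ 1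
  multOrder≡1 {d = suc zero}    _                    _     = refl
  multOrder≡1 {p} {d = suc (suc d)} (_ , _ , minimal) n∣p∸1 =
    contradiction (subst (λ q → _ ∣ q ∸ 1) (sym (*-identityʳ p)) n∣p∸1) (minimal 1 ≤-refl (s≤s (s≤s z≤n)))

  coprime-3⇒%3≢0 : ∀ j → Coprime j 3 → j % 3 ≢ 0
  coprime-3⇒%3≢0 j coprime j%3≡0 with coprime (m%n≡0⇒n∣m j 3 j%3≡0 , ∣-refl)
  ... | ()

  multOrder-mod-3 : ∀ {p d} .{{_ : NonZero p}} → MultOrder p 3 d → d ≡ 1 ⊎ p % 3 ≡ 2
  multOrder-mod-3 {p} {d} mo@(1≤d , 3∣pᵈ-1 , _) with p % 3 in p%3≡r
  ... | 0 = contradiction (∣n∧∣n^[1+k]∸1⇒≡1 (pred d) (m%n≡0⇒n∣m p 3 p%3≡r) 3∣p^[1+d′]∸1) λ ()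
    where
    3∣p^[1+d′]∸1 : 3 ∣ p ^ suc (pred d) ∸ 1
    3∣p^[1+d′]∸1 = subst (λ e → 3 ∣ p ^ e ∸ 1) (sym (suc-pred d {{>-nonZero 1≤d}})) 3∣pᵈ-1
  ... | 1 = inj₁ (multOrder≡1 mo (%≡1⇒∣∸1 p 3 p%3≡r))
  ... | 2 = inj₂ refl
  ... | suc (suc (suc r)) = contradiction (subst (_< 3) p%3≡r (m%n<n p 3)) λ { (s≤s (s≤s (s≤s ()))) }

open Arithmetic

unique-lookup-injective : ∀ {A : Set} {xs : List A} → Unique xs → ∀ i j → lookup xs i ≡ lookup xs j → i ≡ j
unique-lookup-injective (_ ∷ _)    zero    zero    _  = refl
unique-lookup-injective (x∉xs ∷ _) zero    (suc j) eq = ⊥-elim (All.lookup x∉xs (∈-lookup j) eq)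
unique-lookup-injective (x∉xs ∷ _) (suc i) zero    eq = ⊥-elim (All.lookup x∉xs (∈-lookup i) (sym eq))
unique-lookup-injective (_ ∷ u)    (suc i) (suc j) eq = cong suc (unique-lookup-injective u i j eq)

Fin-injective⇒surjective : ∀ {n} (f : Fin n → Fin n) → Injective _≡_ _≡_ f → ∀ k → ∃ λ i → f i ≡ k
Fin-injective⇒surjective {suc m} f f-injective k with Fin.any? (λ i → f i Fin.≟ k)
... | yes hit = hit
... | no miss = ⊥-elim (ℕ.<-irrefl refl (Fin.injective⇒≤ {f = squeeze} squeeze-injective))
  where
  f≢k : ∀ i → k ≢ f i
  f≢k i k≡fi = miss (i , sym k≡fi)
  squeeze : Fin (suc m) → Fin m
  squeeze i = Fin.punchOut (f≢k i)
  squeeze-injective : Injective _≡_ _≡_ squeeze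
  squeeze-injective eq = f-injective (Fin.punchOut-injective (f≢k _) (f≢k _) eq)

module FieldProperties (F : FiniteField) where
  open FiniteField F public

  commutativeRing : CommutativeRing _ _
  commutativeRing = record { isCommutativeRing = isCommutativeRing }

  open CommutativeRing commutativeRing public
    using ( +-assoc; +-comm; +-identityˡ; +-identityʳ; -‿inverseˡ; -‿inverseʳ
          ; *-assoc; *-comm; *-identityˡ; *-identityʳ; distribʳ; zeroˡ; zeroʳ
          ; +-rawMonoid )
  open import Algebra.Properties.Ring (CommutativeRing.ring commutativeRing) public
    using (-0#≈0#; -‿involutive; -‿injective; -‿distribˡ-*; -‿distribʳ-*; -‿+-comm; +-cancelˡ; +-cancelʳ; x∙y⁻¹≈ε⇒x≈y)
  open import Algebra.Properties.Semiring.Exp (CommutativeRing.semiring commutativeRing) using () renaming (_^_ to _^ˢ_)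
  open import Algebra.Properties.Semiring.Mult.TCOptimised (CommutativeRing.semiring commutativeRing)
    using (×-homo-+; ×1-homo-*; 1+×; ×ᵤ≈×) renaming (_×_ to _times_)

  -- The optimised multiplication makes fromℕ 1 reduce to 1#, which the ring solver relies on.
  fromℕ : ℕ → Carrier
  fromℕ n = n times 1#

  fromℕ-suc : ∀ n → fromℕ (suc n) ≡ 1# + fromℕ n
  fromℕ-suc n = 1+× n 1#

  fromℤ : ℤ → Carrier
  fromℤ (ℤ.+ n)    = fromℕ n
  fromℤ -[1+ n ] = - fromℕ (suc n)

  private
    signed : Sign → Carrier → Carrier
    signed Sign.+ x = x
    signed Sign.- x = - x

    fromℤ-◃ : ∀ s n → fromℤ (s ◃ n) ≡ signed s (fromℕ n)
    fromℤ-◃ Sign.+ n       = cong fromℤ (ℤ.+◃n≡+n n)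
    fromℤ-◃ Sign.- zero    = sym -0#≈0#
    fromℤ-◃ Sign.- (suc n) = refl

    signed-* : ∀ s t x y → signed (s Sign.* t) (x * y) ≡ signed s x * signed t y
    signed-* Sign.+ Sign.+ x y = refl
    signed-* Sign.+ Sign.- x y = -‿distribʳ-* x y
    signed-* Sign.- Sign.+ x y = -‿distribˡ-* x y
    signed-* Sign.- Sign.- x y = trans (sym (-‿involutive (x * y)))
                                       (trans (cong -_ (-‿distribˡ-* x y)) (-‿distribʳ-* (- x) y))

  fromℤ-homo-- : ∀ i → fromℤ (ℤ.- i) ≡ - fromℤ i
  fromℤ-homo-- (ℤ.+ zero)  = sym -0#≈0#
  fromℤ-homo-- (ℤ.+ suc n) = refl
  fromℤ-homo-- -[1+ n ]  = sym (-‿involutive _)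

  fromℤ-⊖ : ∀ m n → fromℤ (m ⊖ n) ≡ fromℕ m + - fromℕ n
  fromℤ-⊖ m       zero    = sym (trans (cong (fromℕ m +_) -0#≈0#) (+-identityʳ _))
  fromℤ-⊖ zero    (suc n) = sym (+-identityˡ _)
  fromℤ-⊖ (suc m) (suc n) = begin
    fromℤ (suc m ⊖ suc n)                ≡⟨ cong fromℤ (ℤ.[1+m]⊖[1+n]≡m⊖n m n) ⟩
    fromℤ (m ⊖ n)                        ≡⟨ fromℤ-⊖ m n ⟩
    fromℕ m + - fromℕ n                  ≡⟨ add-and-subtract-1 (fromℕ m) (fromℕ n) ⟩
    (1# + fromℕ m) + - (1# + fromℕ n)    ≡⟨ sym (cong₂ (λ a b → a + - b) (fromℕ-suc m) (fromℕ-suc n)) ⟩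
    fromℕ (suc m) + - fromℕ (suc n)      ∎
    where
    open ≡-Reasoning
    add-and-subtract-1 : ∀ a b → a + - b ≡ (1# + a) + - (1# + b)
    add-and-subtract-1 a b = begin
      a + - b                      ≡⟨ cong (_+ - b) (sym (+-identityˡ a)) ⟩
      0# + a + - b                 ≡⟨ cong (λ z → z + a + - b) (sym (-‿inverseʳ 1#)) ⟩
      1# + - 1# + a + - b          ≡⟨ cong (_+ - b) (+-assoc 1# (- 1#) a) ⟩
      1# + (- 1# + a) + - b        ≡⟨ cong (λ z → 1# + z + - b) (+-comm (- 1#) a) ⟩
      1# + (a + - 1#) + - b        ≡⟨ cong (_+ - b) (sym (+-assoc 1# a (- 1#))) ⟩
      1# + a + - 1# + - b          ≡⟨ +-assoc (1# + a) (- 1#) (- b) ⟩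
      1# + a + (- 1# + - b)        ≡⟨ cong (1# + a +_) (-‿+-comm 1# b) ⟩
      1# + a + - (1# + b)          ∎

  fromℤ-homo-+ : ∀ i j → fromℤ (i ℤ.+ j) ≡ fromℤ i + fromℤ j
  fromℤ-homo-+ (ℤ.+ m)    (ℤ.+ n)    = ×-homo-+ 1# m n
  fromℤ-homo-+ (ℤ.+ m)    -[1+ n ] = fromℤ-⊖ m (suc n)
  fromℤ-homo-+ -[1+ m ] (ℤ.+ n)    = trans (fromℤ-⊖ n (suc m)) (+-comm _ _)
  fromℤ-homo-+ -[1+ m ] -[1+ n ] = begin
    - fromℕ (suc (suc (m ℕ.+ n)))       ≡⟨ cong (λ k → - fromℕ (suc k)) (sym (ℕ.+-suc m n)) ⟩
    - fromℕ (suc m ℕ.+ suc n)           ≡⟨ cong -_ (×-homo-+ 1# (suc m) (suc n)) ⟩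
    - (fromℕ (suc m) + fromℕ (suc n))   ≡⟨ sym (-‿+-comm _ _) ⟩
    - fromℕ (suc m) + - fromℕ (suc n)   ∎
    where open ≡-Reasoning

  fromℤ-homo-* : ∀ i j → fromℤ (i ℤ.* j) ≡ fromℤ i * fromℤ j
  fromℤ-homo-* i j = begin
    fromℤ (i ℤ.* j)                                         ≡⟨ fromℤ-◃ (sign i Sign.* sign j) (∣ i ∣ ℕ.* ∣ j ∣) ⟩
    signed (sign i Sign.* sign j) (fromℕ (∣ i ∣ ℕ.* ∣ j ∣))  ≡⟨ cong (signed (sign i Sign.* sign j)) (×1-homo-* ∣ i ∣ ∣ j ∣) ⟩
    signed (sign i Sign.* sign j) (fromℕ ∣ i ∣ * fromℕ ∣ j ∣) ≡⟨ signed-* (sign i) (sign j) _ _ ⟩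
    signed (sign i) (fromℕ ∣ i ∣) * signed (sign j) (fromℕ ∣ j ∣) ≡⟨ sym (cong₂ _*_ (signed-abs i) (signed-abs j)) ⟩
    fromℤ i * fromℤ j                                       ∎
    where
    open ≡-Reasoning
    signed-abs : ∀ i → fromℤ i ≡ signed (sign i) (fromℕ ∣ i ∣)
    signed-abs i = trans (cong fromℤ (sym (ℤ.◃-inverse i))) (fromℤ-◃ (sign i) ∣ i ∣)

  fromℤ-homomorphism : ℤ.+-*-rawRing -Raw-AlmostCommutative⟶ fromCommutativeRing commutativeRing
  fromℤ-homomorphism = record
    { ⟦_⟧ = fromℤ ; +-homo = fromℤ-homo-+ ; *-homo = fromℤ-homo-* ; -‿homo = fromℤ-homo--
    ; 0-homo = refl ; 1-homo = refl }

  private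
    fromℤ-≟ : ∀ i j → Maybe (fromℤ i ≡ fromℤ j)
    fromℤ-≟ i j = Maybe.map (cong fromℤ) (dec⇒maybe (i ℤ.≟ j))

  open import Algebra.Solver.Ring ℤ.+-*-rawRing (fromCommutativeRing commutativeRing) fromℤ-homomorphism fromℤ-≟ public
    using (solve; _:=_; _:+_; _:*_; :-_; _:-_; con)

  position : Carrier → Fin size
  position a = index (elements-complete a)

  lookup-position : ∀ a → lookup elements (position a) ≡ a
  lookup-position a = sym (lookup-index (elements-complete a))

  position-lookup : ∀ i → position (lookup elements i) ≡ i
  position-lookup i = unique-lookup-injective elements-unique _ _ (lookup-position (lookup elements i))

  position-injective : ∀ {a b} → position a ≡ position b → a ≡ b
  position-injective {a} {b} eq = trans (sym (lookup-position a)) (trans (cong (lookup elements) eq) (lookup-position b))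

  infix 4 _≟_
  _≟_ : (a b : Carrier) → Dec (a ≡ b)
  a ≟ b with position a Fin.≟ position b
  ... | yes eq = yes (position-injective eq)
  ... | no neq = no (λ a≡b → neq (cong position a≡b))

  1≢0 : 1# ≢ 0#
  1≢0 1≡0 = 0≢1 (sym 1≡0)

  ⁻¹-inverseˡ : ∀ {a} → a ≢ 0# → a ⁻¹ * a ≡ 1#
  ⁻¹-inverseˡ {a} a≢0 = trans (*-comm _ _) (⁻¹-inverse a a≢0)

  *-cancelˡ : ∀ {a b c} → a ≢ 0# → a * b ≡ a * c → b ≡ c
  *-cancelˡ {a} {b} {c} a≢0 eq = begin
    b                ≡⟨ sym (*-identityˡ b) ⟩
    1# * b           ≡⟨ cong (_* b) (sym (⁻¹-inverseˡ a≢0)) ⟩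
    a ⁻¹ * a * b     ≡⟨ *-assoc _ _ _ ⟩
    a ⁻¹ * (a * b)   ≡⟨ cong (a ⁻¹ *_) eq ⟩
    a ⁻¹ * (a * c)   ≡⟨ sym (*-assoc _ _ _) ⟩
    a ⁻¹ * a * c     ≡⟨ cong (_* c) (⁻¹-inverseˡ a≢0) ⟩
    1# * c           ≡⟨ *-identityˡ c ⟩
    c                ∎
    where open ≡-Reasoning

  *≢0 : ∀ {a b} → a ≢ 0# → b ≢ 0# → a * b ≢ 0#
  *≢0 {a} {b} a≢0 b≢0 ab≡0 = b≢0 (*-cancelˡ a≢0 (trans ab≡0 (sym (zeroʳ a))))

  ⁻¹≢0 : ∀ {a} → a ≢ 0# → a ⁻¹ ≢ 0#
  ⁻¹≢0 {a} a≢0 a⁻¹≡0 = 0≢1 (trans (sym (zeroʳ a)) (trans (cong (a *_) (sym a⁻¹≡0)) (⁻¹-inverse a a≢0)))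

  *≡0⇒≡0 : ∀ {a b} → a * b ≡ 0# → a ≡ 0# ⊎ b ≡ 0#
  *≡0⇒≡0 {a} {b} ab≡0 with a ≟ 0# | b ≟ 0#
  ... | yes a≡0 | _       = inj₁ a≡0
  ... | no _    | yes b≡0 = inj₂ b≡0
  ... | no a≢0  | no b≢0  = ⊥-elim (*≢0 a≢0 b≢0 ab≡0)

  ⁻¹-unique : ∀ {a b} → a * b ≡ 1# → a ⁻¹ ≡ b
  ⁻¹-unique {a} {b} ab≡1 = *-cancelˡ a≢0 (trans (⁻¹-inverse a a≢0) (sym ab≡1))
    where
    a≢0 : a ≢ 0#
    a≢0 a≡0 = 0≢1 (trans (sym (zeroˡ b)) (trans (cong (_* b) (sym a≡0)) ab≡1))

  x-y≡0⇒x≡y : ∀ {a b} → a + - b ≡ 0# → a ≡ b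
  x-y≡0⇒x≡y = x∙y⁻¹≈ε⇒x≈y _ _

  pow-homo-+ : ∀ a m n → pow a (m ℕ.+ n) ≡ pow a m * pow a n
  pow-homo-+ a zero    n = sym (*-identityˡ _)
  pow-homo-+ a (suc m) n = trans (cong (a *_) (pow-homo-+ a m n)) (sym (*-assoc _ _ _))

  pow-assoc : ∀ a m n → pow a (m ℕ.* n) ≡ pow (pow a m) n
  pow-assoc a m zero    = cong (pow a) (ℕ.*-zeroʳ m)
  pow-assoc a m (suc n) = begin
    pow a (m ℕ.* suc n)            ≡⟨ cong (pow a) (ℕ.*-suc m n) ⟩
    pow a (m ℕ.+ m ℕ.* n)          ≡⟨ pow-homo-+ a m (m ℕ.* n) ⟩
    pow a m * pow a (m ℕ.* n)      ≡⟨ cong (pow a m *_) (pow-assoc a m n) ⟩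
    pow a m * pow (pow a m) n      ∎
    where open ≡-Reasoning

  pow-1# : ∀ n → pow 1# n ≡ 1#
  pow-1# zero    = refl
  pow-1# (suc n) = trans (*-identityˡ _) (pow-1# n)

  pow-distrib-* : ∀ a b n → pow (a * b) n ≡ pow a n * pow b n
  pow-distrib-* a b zero    = sym (*-identityˡ 1#)
  pow-distrib-* a b (suc n) = trans (cong (a * b *_) (pow-distrib-* a b n)) (interchange a b (pow a n) (pow b n))
    where
    interchange : ∀ a b c d → a * b * (c * d) ≡ a * c * (b * d)
    interchange = solve 4 (λ a b c d → a :* b :* (c :* d) := a :* c :* (b :* d)) refl

  pow≢0 : ∀ {a} n → a ≢ 0# → pow a n ≢ 0#
  pow≢0 zero    a≢0 = 1≢0
  pow≢0 (suc n) a≢0 = *≢0 a≢0 (pow≢0 n a≢0)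

  pow≡0⇒≡0 : ∀ {a} n → pow a (suc n) ≡ 0# → a ≡ 0#
  pow≡0⇒≡0 {a} zero    a≡0 = trans (sym (*-identityʳ a)) a≡0
  pow≡0⇒≡0      (suc n) aⁿ⁺²≡0 with *≡0⇒≡0 aⁿ⁺²≡0
  ... | inj₁ a≡0    = a≡0
  ... | inj₂ aⁿ⁺¹≡0 = pow≡0⇒≡0 n aⁿ⁺¹≡0

  injective⇒surjective : (f : Carrier → Carrier) → Injective _≡_ _≡_ f → ∀ b → ∃ λ a → f a ≡ b
  injective⇒surjective f f-injective b
    with Fin-injective⇒surjective (λ i → position (f (lookup elements i))) on-positions (position b)
    where
    on-positions : Injective _≡_ _≡_ (λ i → position (f (lookup elements i)))
    on-positions eq = unique-lookup-injective elements-unique _ _ (f-injective (position-injective eq))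
  ... | i , eq = lookup elements i , position-injective eq

  -- Translation by 1# permutes the elements, so their sum s satisfies s = s + |F| · 1#.
  fromℕ-size≡0 : fromℕ size ≡ 0#
  fromℕ-size≡0 = sym (+-cancelˡ total 0# (fromℕ size) (trans (+-identityʳ total) shifted-total))
    where
    open import Algebra.Properties.CommutativeMonoid.Sum (CommutativeRing.+-commutativeMonoid commutativeRing)
      using (sum; sum-permute; ∑-distrib-+; sum-replicate; sum-cong-≗)
    element : Fin size → Carrier
    element = lookup elements
    total : Carrier
    total = sum element
    shift : Carrier → Fin size → Fin size
    shift a i = position (element i + a)
    shift-back : ∀ a b → (∀ u → u + a + b ≡ u) → ∀ i → shift b (shift a i) ≡ i
    shift-back a b cancels i = begin
      position (element (position (element i + a)) + b) ≡⟨ cong (λ u → position (u + b)) (lookup-position _) ⟩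
      position (element i + a + b)                      ≡⟨ cong position (cancels (element i)) ⟩
      position (element i)                              ≡⟨ position-lookup i ⟩
      i                                                 ∎
      where open ≡-Reasoning
    shift-by-1 : Permutation′ size
    shift-by-1 = permutation (shift 1#) (shift (- 1#))
      (shift-back (- 1#) 1# (solve 1 (λ u → u :- con (ℤ.+ 1) :+ con (ℤ.+ 1) := u) refl))
      (shift-back 1# (- 1#) (solve 1 (λ u → u :+ con (ℤ.+ 1) :- con (ℤ.+ 1) := u) refl))
    shifted-total : total ≡ total + fromℕ size
    shifted-total = begin
      total                                 ≡⟨ sum-permute element shift-by-1 ⟩
      sum (λ i → element (shift 1# i))      ≡⟨ sum-cong-≗ (λ i → lookup-position (element i + 1#)) ⟩
      sum (λ i → element i + 1#)            ≡⟨ ∑-distrib-+ element (λ _ → 1#) ⟩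
      total + sum {size} (λ _ → 1#)         ≡⟨ cong (total +_) (trans (sum-replicate size) (×ᵤ≈× size 1#)) ⟩
      total + fromℕ size                    ∎
      where open ≡-Reasoning

  fromℕ-homo-pow : ∀ m d → fromℕ (m ℕ.^ d) ≡ pow (fromℕ m) d
  fromℕ-homo-pow m zero    = refl
  fromℕ-homo-pow m (suc d) = trans (×1-homo-* m (m ℕ.^ d)) (cong (fromℕ m *_) (fromℕ-homo-pow m d))

  characteristic : ∀ p d → 1 ℕ.≤ d → size ≡ p ℕ.^ d → fromℕ p ≡ 0#
  characteristic p (suc d) _ size≡pᵈ =
    pow≡0⇒≡0 d (trans (sym (fromℕ-homo-pow p (suc d))) (trans (cong fromℕ (sym size≡pᵈ)) fromℕ-size≡0))

  private
    fromℕ-multiple-of-0 : ∀ x {a} → fromℕ a ≡ 0# → fromℕ (x ℕ.* a) ≡ 0#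
    fromℕ-multiple-of-0 x {a} a≡0 = trans (×1-homo-* x a) (trans (cong (fromℕ x *_) a≡0) (zeroʳ _))

    1+x*a≢y*b : ∀ {a b} x y → fromℕ a ≡ 0# → fromℕ b ≡ 0# → 1 ℕ.+ x ℕ.* a ≢ y ℕ.* b
    1+x*a≢y*b {a} {b} x y a≡0 b≡0 eq = 1≢0 (begin
      1#                      ≡⟨ sym (+-identityʳ 1#) ⟩
      1# + 0#                 ≡⟨ cong (1# +_) (sym (fromℕ-multiple-of-0 x a≡0)) ⟩
      1# + fromℕ (x ℕ.* a)    ≡⟨ sym (fromℕ-suc (x ℕ.* a)) ⟩
      fromℕ (1 ℕ.+ x ℕ.* a)   ≡⟨ cong fromℕ eq ⟩
      fromℕ (y ℕ.* b)         ≡⟨ fromℕ-multiple-of-0 y b≡0 ⟩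
      0#                      ∎)
      where open ≡-Reasoning

    fromℕ-difference≡0 : ∀ {m n} → m ℕ.< n → fromℕ m ≡ fromℕ n → fromℕ (n ℕ.∸ m) ≡ 0#
    fromℕ-difference≡0 {m} {n} m<n eq = sym (+-cancelˡ (fromℕ m) 0# (fromℕ (n ℕ.∸ m)) (begin
      fromℕ m + 0#                 ≡⟨ +-identityʳ _ ⟩
      fromℕ m                      ≡⟨ eq ⟩
      fromℕ n                      ≡⟨ cong fromℕ (sym (ℕ.m+[n∸m]≡n (ℕ.<⇒≤ m<n))) ⟩
      fromℕ (m ℕ.+ (n ℕ.∸ m))      ≡⟨ ×-homo-+ 1# m (n ℕ.∸ m) ⟩
      fromℕ m + fromℕ (n ℕ.∸ m)    ∎))
      where open ≡-Reasoning

  module PrimeCharacteristic {p} (p-prime : Prime p) (p≡0 : fromℕ p ≡ 0#) where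

    -- A Bézout identity for k and p would write 1 as a combination of elements that vanish in F.
    fromℕ≢0 : ∀ {k} → 0 ℕ.< k → k ℕ.< p → fromℕ k ≢ 0#
    fromℕ≢0 0<k k<p k≡0 with coprime-Bézout (prime⇒coprime p-prime {{ℕ.>-nonZero 0<k}} k<p)
    ... | Bézout.+- x y eq = 1+x*a≢y*b y x k≡0 p≡0 eq
    ... | Bézout.-+ x y eq = 1+x*a≢y*b x y p≡0 k≡0 eq

    fromℕ-injective : ∀ {i j} → i ℕ.< p → j ℕ.< p → fromℕ i ≡ fromℕ j → i ≡ j
    fromℕ-injective {i} {j} i<p j<p eq with ℕ.<-cmp i j
    ... | tri≈ _ i≡j _ = i≡j
    ... | tri< i<j _ _ = ⊥-elim (fromℕ≢0 (ℕ.m<n⇒0<n∸m i<j) (ℕ.≤-<-trans (ℕ.m∸n≤m j i) j<p) (fromℕ-difference≡0 i<j eq))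
    ... | tri> _ _ j<i = ⊥-elim (fromℕ≢0 (ℕ.m<n⇒0<n∸m j<i) (ℕ.≤-<-trans (ℕ.m∸n≤m i j) i<p) (fromℕ-difference≡0 j<i (sym eq)))

    prime-field : size ≡ p → ∀ b → ∃ λ k → fromℕ k ≡ b
    prime-field size≡p b with Fin-injective⇒surjective (λ i → position (fromℕ (Fin.toℕ i))) injective (position b)
      where
      below-p : (i : Fin size) → Fin.toℕ i ℕ.< p
      below-p i = subst (Fin.toℕ i ℕ.<_) size≡p (Fin.toℕ<n i)
      injective : Injective _≡_ _≡_ (λ i → position (fromℕ (Fin.toℕ i)))
      injective {i} {j} eq = Fin.toℕ-injective (fromℕ-injective (below-p i) (below-p j) (position-injective eq))
    ... | i , eq = Fin.toℕ i , position-injective eq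

  pow≗^ : ∀ a n → pow a n ≡ a ^ˢ n
  pow≗^ a zero    = refl
  pow≗^ a (suc n) = cong (a *_) (pow≗^ a n)

  module _ (a b : Carrier) where
    open import Algebra.Properties.Semiring.Binomial (CommutativeRing.semiring commutativeRing) a b
      using (theorem; binomialTerm)
    open import Algebra.Properties.Semiring.Sum (CommutativeRing.semiring commutativeRing)
      using (sum; sum-init-last; sum-cong-≗; sum-replicate-zero)
    open import Algebra.Properties.Semiring.Mult (CommutativeRing.semiring commutativeRing)
      using (×-assoc-*) renaming (_×_ to _×ᵤ_)

    binomialTerm≡ : ∀ n k → binomialTerm n k ≡ fromℕ (n C Fin.toℕ k) * (pow a (Fin.toℕ k) * pow b (n ℕ.∸ Fin.toℕ k))
    binomialTerm≡ n k = begin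
      (n C i) ×ᵤ (a ^ˢ i * b ^ˢ (n ℕ.∸ i))      ≡⟨ cong ((n C i) ×ᵤ_) (sym (*-identityˡ _)) ⟩
      (n C i) ×ᵤ (1# * (a ^ˢ i * b ^ˢ (n ℕ.∸ i))) ≡⟨ sym (×-assoc-* (n C i) 1# _) ⟩
      (n C i) ×ᵤ 1# * (a ^ˢ i * b ^ˢ (n ℕ.∸ i))   ≡⟨ cong₂ _*_ (×ᵤ≈× (n C i) 1#) (sym (cong₂ _*_ (pow≗^ a i) (pow≗^ b (n ℕ.∸ i)))) ⟩
      fromℕ (n C i) * (pow a i * pow b (n ℕ.∸ i)) ∎
      where
      open ≡-Reasoning
      i = Fin.toℕ k

    -- Only the two extreme binomial coefficients survive, since p divides all the others.
    freshmans-dream : ∀ {p} → Prime p → fromℕ p ≡ 0# → pow (a + b) p ≡ pow a p + pow b p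
    freshmans-dream {suc p′} p-prime p≡0 = begin
      pow (a + b) p                                          ≡⟨ pow≗^ (a + b) p ⟩
      (a + b) ^ˢ p                                           ≡⟨ theorem (*-comm a b) p ⟩
      term zero + sum (λ i → term (suc i))                   ≡⟨ cong (term zero +_) (sum-init-last (λ i → term (suc i))) ⟩
      term zero + (sum (λ i → term (suc (Fin.inject₁ i))) + term (suc (Fin.fromℕ p′)))
        ≡⟨ cong (λ s → term zero + (s + term (suc (Fin.fromℕ p′)))) (trans (sum-cong-≗ inner-term≡0) (sum-replicate-zero p′)) ⟩
      term zero + (0# + term (suc (Fin.fromℕ p′)))           ≡⟨ cong₂ (λ u v → u + (0# + v)) first-term last-term ⟩
      pow b p + (0# + pow a p)                               ≡⟨ cong (pow b p +_) (+-identityˡ _) ⟩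
      pow b p + pow a p                                      ≡⟨ +-comm _ _ ⟩
      pow a p + pow b p                                      ∎
      where
      open ≡-Reasoning
      p = suc p′
      term : Fin (suc p) → Carrier
      term = binomialTerm p
      first-term : term zero ≡ pow b p
      first-term = trans (binomialTerm≡ p zero) (trans (*-identityˡ _) (*-identityˡ _))
      last-term : term (suc (Fin.fromℕ p′)) ≡ pow a p
      last-term = begin
        term (suc (Fin.fromℕ p′))                               ≡⟨ binomialTerm≡ p (suc (Fin.fromℕ p′)) ⟩
        fromℕ (p C suc k) * (pow a (suc k) * pow b (p′ ℕ.∸ k))  ≡⟨ cong (λ k → fromℕ (p C suc k) * (pow a (suc k) * pow b (p′ ℕ.∸ k))) (Fin.toℕ-fromℕ p′) ⟩
        fromℕ (p C p) * (pow a p * pow b (p′ ℕ.∸ p′))           ≡⟨ cong₂ (λ n m → fromℕ n * (pow a p * pow b m)) (nCn≡1 p) (ℕ.n∸n≡0 p′) ⟩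
        1# * (pow a p * 1#)                                     ≡⟨ trans (*-identityˡ _) (*-identityʳ _) ⟩
        pow a p                                                 ∎
        where k = Fin.toℕ (Fin.fromℕ p′)
      inner-term≡0 : ∀ i → term (suc (Fin.inject₁ i)) ≡ 0#
      inner-term≡0 i with prime∣choose p-prime (ℕ.s≤s ℕ.z≤n) (ℕ.s≤s (subst (ℕ._< p′) (sym (Fin.toℕ-inject₁ i)) (Fin.toℕ<n i)))
      ... | divides q p∣C = trans (binomialTerm≡ p (suc (Fin.inject₁ i)))
                                  (trans (cong (_* monomial) (trans (cong fromℕ p∣C) (fromℕ-multiple-of-0 q p≡0))) (zeroˡ _))
        where
        monomial : Carrier
        monomial = pow a (suc (Fin.toℕ (Fin.inject₁ i))) * pow b (p ℕ.∸ suc (Fin.toℕ (Fin.inject₁ i)))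

  record FieldAutomorphism : Set where
    field
      σ           : Carrier → Carrier
      σ-homo-+    : ∀ a b → σ (a + b) ≡ σ a + σ b
      σ-homo-*    : ∀ a b → σ (a * b) ≡ σ a * σ b
      σ-homo-1    : σ 1# ≡ 1#
      σ-injective : Injective _≡_ _≡_ σ

    σ-surjective : ∀ b → ∃ λ a → σ a ≡ b
    σ-surjective = injective⇒surjective σ σ-injective

    σ-homo-0 : σ 0# ≡ 0#
    σ-homo-0 = sym (+-cancelˡ (σ 0#) 0# (σ 0#)
      (trans (+-identityʳ _) (trans (cong σ (sym (+-identityʳ 0#))) (σ-homo-+ 0# 0#))))

    σ-homo-pow : ∀ a k → σ (pow a k) ≡ pow (σ a) k
    σ-homo-pow a zero    = σ-homo-1
    σ-homo-pow a (suc k) = trans (σ-homo-* a (pow a k)) (cong (σ a *_) (σ-homo-pow a k))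

    σ≢0 : ∀ {a} → a ≢ 0# → σ a ≢ 0#
    σ≢0 a≢0 σa≡0 = a≢0 (σ-injective (trans σa≡0 (sym σ-homo-0)))

  identityAutomorphism : FieldAutomorphism
  identityAutomorphism = record
    { σ = λ a → a ; σ-homo-+ = λ _ _ → refl ; σ-homo-* = λ _ _ → refl ; σ-homo-1 = refl ; σ-injective = λ eq → eq }

  frobenius : ∀ {p} → Prime p → fromℕ p ≡ 0# → FieldAutomorphism
  frobenius {p} p-prime p≡0 = record
    { σ           = λ a → pow a p
    ; σ-homo-+    = λ a b → freshmans-dream a b p-prime p≡0
    ; σ-homo-*    = λ a b → pow-distrib-* a b p
    ; σ-homo-1    = pow-1# p
    ; σ-injective = injective
    }
    where
    p≡1+p′ : p ≡ suc (ℕ.pred p)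
    p≡1+p′ = sym (ℕ.suc-pred p {{prime⇒nonZero p-prime}})
    pow-0# : pow 0# p ≡ 0#
    pow-0# = trans (cong (pow 0#) p≡1+p′) (zeroˡ _)
    pow-homo-- : ∀ b → pow (- b) p ≡ - pow b p
    pow-homo-- b = +-cancelʳ (pow b p) (pow (- b) p) (- pow b p) (begin
      pow (- b) p + pow b p  ≡⟨ sym (freshmans-dream (- b) b p-prime p≡0) ⟩
      pow (- b + b) p        ≡⟨ cong (λ x → pow x p) (-‿inverseˡ b) ⟩
      pow 0# p               ≡⟨ pow-0# ⟩
      0#                     ≡⟨ sym (-‿inverseˡ (pow b p)) ⟩
      - pow b p + pow b p    ∎)
      where open ≡-Reasoning
    injective : Injective _≡_ _≡_ (λ a → pow a p)
    injective {a} {b} aᵖ≡bᵖ = x-y≡0⇒x≡y (pow≡0⇒≡0 (ℕ.pred p) (subst (λ n → pow (a + - b) n ≡ 0#) p≡1+p′ (begin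
      pow (a + - b) p         ≡⟨ freshmans-dream a (- b) p-prime p≡0 ⟩
      pow a p + pow (- b) p   ≡⟨ cong₂ _+_ aᵖ≡bᵖ (pow-homo-- b) ⟩
      pow b p + - pow b p     ≡⟨ -‿inverseʳ _ ⟩
      0#                      ∎)))
      where open ≡-Reasoning

module CyclicSubgroup {F : FiniteField} {n : ℕ} (S : MultSubgroup F n) (g : FiniteField.Carrier F)
  (g∈S : g ∈ MultSubgroup.elems S)
  (generates : ∀ a → a ∈ MultSubgroup.elems S → Σ ℕ λ k → a ≡ FiniteField.pow F g k) where
  open FieldProperties F
  open MultSubgroup S

  pow∈S : ∀ {a} k → a ∈ elems → pow a k ∈ elems
  pow∈S zero    _   = one∈
  pow∈S (suc k) a∈S = mul∈ _ _ a∈S (pow∈S k a∈S)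

  g≢0 : g ≢ 0#
  g≢0 = elems-nonzero g g∈S

  pow-mod : ∀ m .{{_ : ℕ.NonZero m}} → pow g m ≡ 1# → ∀ k → pow g k ≡ pow g (k % m)
  pow-mod m gᵐ≡1 k = begin
    pow g k                                  ≡⟨ cong (pow g) (m≡m%n+[m/n]*n k m) ⟩
    pow g (k % m ℕ.+ k / m ℕ.* m)            ≡⟨ pow-homo-+ g (k % m) _ ⟩
    pow g (k % m) * pow g (k / m ℕ.* m)      ≡⟨ cong (λ e → pow g (k % m) * pow g e) (ℕ.*-comm (k / m) m) ⟩
    pow g (k % m) * pow g (m ℕ.* (k / m))    ≡⟨ cong (pow g (k % m) *_) (pow-assoc g m (k / m)) ⟩
    pow g (k % m) * pow (pow g m) (k / m)    ≡⟨ cong (λ x → pow g (k % m) * pow x (k / m)) gᵐ≡1 ⟩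
    pow g (k % m) * pow 1# (k / m)           ≡⟨ cong (pow g (k % m) *_) (pow-1# (k / m)) ⟩
    pow g (k % m) * 1#                       ≡⟨ *-identityʳ _ ⟩
    pow g (k % m)                            ∎
    where open ≡-Reasoning

  -- Reducing exponents modulo m maps S injectively into Fin m.
  order≤ : ∀ m → pow g (suc m) ≡ 1# → n ℕ.≤ suc m
  order≤ m gᵐ⁺¹≡1 = subst (ℕ._≤ suc m) elems-order (Fin.injective⇒≤ {f = residue} residue-injective)
    where
    exponent : Fin (length elems) → ℕ
    exponent i = proj₁ (generates (lookup elems i) (∈-lookup i))
    residue : Fin (length elems) → Fin (suc m)
    residue i = Fin.fromℕ< (m%n<n (exponent i) (suc m))
    residue-injective : ∀ {i j} → residue i ≡ residue j → i ≡ j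
    residue-injective {i} {j} eq = unique-lookup-injective elems-unique i j (begin
      lookup elems i                   ≡⟨ proj₂ (generates (lookup elems i) (∈-lookup i)) ⟩
      pow g (exponent i)               ≡⟨ pow-mod (suc m) gᵐ⁺¹≡1 (exponent i) ⟩
      pow g (exponent i % suc m)       ≡⟨ cong (pow g) (Fin.fromℕ<-injective _ _ (m%n<n (exponent i) (suc m)) (m%n<n (exponent j) (suc m)) eq) ⟩
      pow g (exponent j % suc m)       ≡⟨ sym (pow-mod (suc m) gᵐ⁺¹≡1 (exponent j)) ⟩
      pow g (exponent j)               ≡⟨ sym (proj₂ (generates (lookup elems j) (∈-lookup j))) ⟩
      lookup elems j                   ∎)
      where open ≡-Reasoning

  pow-cancel : ∀ i m → pow g i ≡ pow g (i ℕ.+ m) → pow g m ≡ 1#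
  pow-cancel i m eq = *-cancelˡ (pow≢0 i g≢0) (begin
    pow g i * pow g m    ≡⟨ sym (pow-homo-+ g i m) ⟩
    pow g (i ℕ.+ m)      ≡⟨ sym eq ⟩
    pow g i              ≡⟨ sym (*-identityʳ _) ⟩
    pow g i * 1#         ∎)
    where open ≡-Reasoning

  1≤n : 1 ℕ.≤ n
  1≤n = subst (1 ℕ.≤_) elems-order (nonempty one∈)
    where
    nonempty : ∀ {xs : List Carrier} → 1# ∈ xs → 1 ℕ.≤ length xs
    nonempty {_ ∷ _} _ = ℕ.s≤s ℕ.z≤n

  instance
    n≢0 : ℕ.NonZero n
    n≢0 = ℕ.>-nonZero 1≤n

  private
    position-of-power : Fin (suc n) → Fin (length elems)
    position-of-power k = index (pow∈S (Fin.toℕ k) g∈S)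

  -- Two of g⁰, …, gⁿ coincide; their ratio gᵐ = 1 has 0 < m ≤ n, and order≤ forces m = n.
  pow-order≡1 : pow g n ≡ 1#
  pow-order≡1 with Fin.pigeonhole (subst (ℕ._< suc n) (sym elems-order) (ℕ.n<1+n n)) position-of-power
  ... | i , j , i<j , eq = subst (λ m → pow g m ≡ 1#) m≡n gᵐ≡1
    where
    m = Fin.toℕ j ℕ.∸ Fin.toℕ i
    gᵐ≡1 : pow g m ≡ 1#
    gᵐ≡1 = pow-cancel (Fin.toℕ i) m (begin
      pow g (Fin.toℕ i)                  ≡⟨ lookup-index (pow∈S (Fin.toℕ i) g∈S) ⟩
      lookup elems (position-of-power i) ≡⟨ cong (lookup elems) eq ⟩
      lookup elems (position-of-power j) ≡⟨ sym (lookup-index (pow∈S (Fin.toℕ j) g∈S)) ⟩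
      pow g (Fin.toℕ j)                  ≡⟨ cong (pow g) (sym (ℕ.m+[n∸m]≡n (ℕ.<⇒≤ i<j))) ⟩
      pow g (Fin.toℕ i ℕ.+ m)            ∎)
      where open ≡-Reasoning
    m≤n : m ℕ.≤ n
    m≤n = ℕ.≤-trans (ℕ.m∸n≤m (Fin.toℕ j) (Fin.toℕ i)) (ℕ.s≤s⁻¹ (Fin.toℕ<n j))
    m≡n : m ≡ n
    m≡n with m | ℕ.m<n⇒0<n∸m i<j | gᵐ≡1 | m≤n
    ... | suc m′ | _ | gᵐ′⁺¹≡1 | m′<n = ℕ.≤-antisym m′<n (order≤ m′ gᵐ′⁺¹≡1)

  pow≡1⇒order∣ : ∀ m → pow g m ≡ 1# → n ∣ m
  pow≡1⇒order∣ m gᵐ≡1 with m % n in m%n≡r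
  ... | zero  = m%n≡0⇒n∣m m n m%n≡r
  ... | suc r = ⊥-elim (ℕ.<⇒≱ (subst (ℕ._< n) m%n≡r (m%n<n m n))
                              (order≤ r (trans (cong (pow g) (sym m%n≡r)) (trans (sym (pow-mod n pow-order≡1 m)) gᵐ≡1))))

  pow≡pow⇒order∣ : ∀ i j → pow g i ≡ pow g j → n ∣ ℕ.∣ i - j ∣
  pow≡pow⇒order∣ i j gⁱ≡gʲ with ℕ.≤-total i j
  ... | inj₁ i≤j = subst (n ∣_) (sym (ℕ.m≤n⇒∣m-n∣≡n∸m i≤j))
                         (pow≡1⇒order∣ _ (pow-cancel i _ (trans gⁱ≡gʲ (cong (pow g) (sym (ℕ.m+[n∸m]≡n i≤j))))))
  ... | inj₂ j≤i = subst (n ∣_) (sym (ℕ.m≤n⇒∣n-m∣≡n∸m j≤i))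
                         (pow≡1⇒order∣ _ (pow-cancel j _ (trans (sym gⁱ≡gʲ) (cong (pow g) (sym (ℕ.m+[n∸m]≡n j≤i))))))

module AffineGroup (F : FiniteField) {n : ℕ} (S : MultSubgroup F n) where
  open FieldProperties F
  open AGL F
  open MultSubgroup S

  ·-closed : ∀ {u v} → InG S u → InG S v → InG S (u · v)
  ·-closed {a , _} {a′ , _} = mul∈ a a′

  ^ᵍ-closed : ∀ {u} k → InG S u → InG S (u ^ᵍ k)
  ^ᵍ-closed zero    _   = one∈
  ^ᵍ-closed {u} (suc k) u∈G = ·-closed {u} {u ^ᵍ k} u∈G (^ᵍ-closed k u∈G)

  idempotent⇒e : ∀ {u} → InG S u → u · u ≡ u → u ≡ e
  idempotent⇒e {a , b} a∈S uu≡u = cong₂ _,_ a≡1 b≡0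
    where
    a≡1 : a ≡ 1#
    a≡1 = sym (*-cancelˡ (elems-nonzero a a∈S) (trans (*-identityʳ a) (sym (cong proj₁ uu≡u))))
    b≡0 : b ≡ 0#
    b≡0 = sym (+-cancelʳ b 0# b (begin
      0# + b       ≡⟨ +-identityˡ b ⟩
      b            ≡⟨ sym (cong proj₂ uu≡u) ⟩
      a * b + b    ≡⟨ cong (λ c → c * b + b) a≡1 ⟩
      1# * b + b   ≡⟨ cong (_+ b) (*-identityˡ b) ⟩
      b + b        ∎))
      where open ≡-Reasoning

  diagonal-^ᵍ : ∀ g k → (g , 0#) ^ᵍ k ≡ (pow g k , 0#)
  diagonal-^ᵍ g zero    = refl
  diagonal-^ᵍ g (suc k) = trans (cong ((g , 0#) ·_) (diagonal-^ᵍ g k))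
                                (cong (g * pow g k ,_) (trans (cong (_+ 0#) (zeroʳ g)) (+-identityʳ 0#)))

  translation-· : ∀ γ δ → (1# , γ) · (1# , δ) ≡ (1# , δ + γ)
  translation-· γ δ = cong₂ _,_ (*-identityˡ 1#) (cong (_+ γ) (*-identityˡ δ))

  translation-·-diagonal : ∀ a β → (1# , β) · (a , 0#) ≡ (a , β)
  translation-·-diagonal a β = cong₂ _,_ (*-identityˡ a) (trans (cong (_+ β) (zeroʳ 1#)) (+-identityˡ β))

  diagonal-conjugates-translation : ∀ g γ → (g , 0#) · (1# , γ) ≡ (1# , g * γ) · (g , 0#)
  diagonal-conjugates-translation g γ =
    cong₂ _,_ (trans (*-identityʳ g) (sym (*-identityˡ g))) (solve 2 (λ g γ → g :* γ :+ con (ℤ.+ 0) := con (ℤ.+ 1) :* con (ℤ.+ 0) :+ g :* γ) refl g γ)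

  module _ (A : FieldAutomorphism)
           (σ-preserves : ∀ a → a ∈ elems → FieldAutomorphism.σ A a ∈ elems)
           (σ-reflects : ∀ a → FieldAutomorphism.σ A a ∈ elems → a ∈ elems) where
    open FieldAutomorphism A

    -- Apply σ to the coefficients of t ↦ a t + β, then conjugate by t ↦ l t + μ.
    affine : Carrier → Carrier → Aff → Aff
    affine l μ (a , β) = (σ a , l * σ β + (1# + - σ a) * μ)

    affine-homo : ∀ l μ u v → affine l μ (u · v) ≡ affine l μ u · affine l μ v
    affine-homo l μ (a , β) (a′ , β′) = cong₂ _,_ (σ-homo-* a a′) (begin
      l * σ (a * β′ + β) + (1# + - σ (a * a′)) * μ
        ≡⟨ cong₂ (λ u w → l * u + (1# + - w) * μ) (trans (σ-homo-+ _ _) (cong (_+ σ β) (σ-homo-* a β′))) (σ-homo-* a a′) ⟩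
      l * (σ a * σ β′ + σ β) + (1# + - (σ a * σ a′)) * μ
        ≡⟨ solve 6 (λ A A′ B B′ l μ → l :* (A :* B′ :+ B) :+ (con (ℤ.+ 1) :- A :* A′) :* μ
                                     := A :* (l :* B′ :+ (con (ℤ.+ 1) :- A′) :* μ) :+ (l :* B :+ (con (ℤ.+ 1) :- A) :* μ))
                 refl (σ a) (σ a′) (σ β) (σ β′) l μ ⟩
      σ a * (l * σ β′ + (1# + - σ a′) * μ) + (l * σ β + (1# + - σ a) * μ) ∎)
      where open ≡-Reasoning

    affine-injective : ∀ {l} μ → l ≢ 0# → ∀ u v → affine l μ u ≡ affine l μ v → u ≡ v
    affine-injective μ l≢0 (a , β) (a′ , β′) eq with σ-injective (cong proj₁ eq)
    ... | refl = cong (a ,_) (σ-injective (*-cancelˡ l≢0 (+-cancelʳ _ _ _ (cong proj₂ eq))))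

    affine-surjective : ∀ {l} μ → l ≢ 0# → ∀ v → InG S v → ∃ λ u → InG S u × affine l μ u ≡ v
    affine-surjective {l} μ l≢0 (a′ , β′) a′∈S with σ-surjective a′ | σ-surjective ((β′ + - ((1# + - a′) * μ)) * l ⁻¹)
    ... | a , σa≡a′ | β , σβ≡target = (a , β) , σ-reflects a (subst (_∈ elems) (sym σa≡a′) a′∈S) , cong₂ _,_ σa≡a′ (begin
      l * σ β + (1# + - σ a) * μ                                          ≡⟨ cong₂ (λ u w → l * u + (1# + - w) * μ) σβ≡target σa≡a′ ⟩
      l * ((β′ + - ((1# + - a′) * μ)) * l ⁻¹) + (1# + - a′) * μ          ≡⟨ solve 4 (λ l l⁻¹ X Y → l :* ((X :- Y) :* l⁻¹) :+ Y := (X :- Y) :* (l :* l⁻¹) :+ Y) refl l (l ⁻¹) β′ ((1# + - a′) * μ) ⟩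
      (β′ + - ((1# + - a′) * μ)) * (l * l ⁻¹) + (1# + - a′) * μ          ≡⟨ cong (λ t → (β′ + - ((1# + - a′) * μ)) * t + (1# + - a′) * μ) (⁻¹-inverse l l≢0) ⟩
      (β′ + - ((1# + - a′) * μ)) * 1# + (1# + - a′) * μ                  ≡⟨ solve 2 (λ X Y → (X :- Y) :* con (ℤ.+ 1) :+ Y := X) refl β′ ((1# + - a′) * μ) ⟩
      β′                                                                  ∎)
      where open ≡-Reasoning

    affineAutomorphism : ∀ {l} μ → l ≢ 0# → Automorphism S
    affineAutomorphism {l} μ l≢0 = record
      { φ        = affine l μ
      ; φ-closed = λ { (a , _) a∈S → σ-preserves a a∈S }
      ; φ-hom    = λ u v _ _ → affine-homo l μ u v
      ; φ-inj    = λ u v _ _ → affine-injective μ l≢0 u v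
      ; φ-surj   = affine-surjective μ l≢0
      }

    affine-isomorphism : ∀ {g b h} → g ≢ 1# → b ≢ 0# → σ g ≡ h →
                         ∀ {a₁ a₂ β₁ β₂} → a₁ ≡ h → a₂ ≡ h → β₁ ≢ β₂ →
                         IsoDessin S ((g , 0#) , (g , b)) ((a₁ , β₁) , (a₂ , β₂))
    affine-isomorphism {g} {b} {h} g≢1 b≢0 σg≡h {β₁ = β₁} {β₂} a₁≡h a₂≡h β₁≢β₂ =
      affineAutomorphism μ l≢0 , cong₂ _,_ (trans σg≡h (sym a₁≡h)) x↦ , cong₂ _,_ (trans σg≡h (sym a₂≡h)) y↦
      where
      open ≡-Reasoning
      1-h≢0 : 1# + - h ≢ 0#
      1-h≢0 1-h≡0 = g≢1 (σ-injective (trans σg≡h (trans (sym (x-y≡0⇒x≡y 1-h≡0)) (sym σ-homo-1))))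
      σb≢0 : σ b ≢ 0#
      σb≢0 = σ≢0 b≢0
      μ = β₁ * (1# + - h) ⁻¹
      l = (β₂ + - β₁) * σ b ⁻¹
      l≢0 : l ≢ 0#
      l≢0 = *≢0 (λ β₂-β₁≡0 → β₁≢β₂ (sym (x-y≡0⇒x≡y β₂-β₁≡0))) (⁻¹≢0 σb≢0)
      x↦ : l * σ 0# + (1# + - σ g) * μ ≡ β₁
      x↦ = begin
        l * σ 0# + (1# + - σ g) * μ               ≡⟨ cong₂ (λ u w → l * u + (1# + - w) * μ) σ-homo-0 σg≡h ⟩
        l * 0# + (1# + - h) * (β₁ * (1# + - h) ⁻¹) ≡⟨ solve 4 (λ l d d⁻¹ β → l :* con (ℤ.+ 0) :+ d :* (β :* d⁻¹) := β :* (d :* d⁻¹)) refl l (1# + - h) ((1# + - h) ⁻¹) β₁ ⟩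
        β₁ * ((1# + - h) * (1# + - h) ⁻¹)          ≡⟨ cong (β₁ *_) (⁻¹-inverse _ 1-h≢0) ⟩
        β₁ * 1#                                    ≡⟨ *-identityʳ β₁ ⟩
        β₁                                         ∎
      y↦ : l * σ b + (1# + - σ g) * μ ≡ β₂
      y↦ = begin
        l * σ b + (1# + - σ g) * μ                          ≡⟨ cong (λ w → l * σ b + (1# + - w) * μ) σg≡h ⟩
        (β₂ + - β₁) * σ b ⁻¹ * σ b + (1# + - h) * (β₁ * (1# + - h) ⁻¹)
          ≡⟨ solve 6 (λ β₁ β₂ s s⁻¹ d d⁻¹ → (β₂ :- β₁) :* s⁻¹ :* s :+ d :* (β₁ :* d⁻¹) := (β₂ :- β₁) :* (s :* s⁻¹) :+ β₁ :* (d :* d⁻¹))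
                   refl β₁ β₂ (σ b) (σ b ⁻¹) (1# + - h) ((1# + - h) ⁻¹) ⟩
        (β₂ + - β₁) * (σ b * σ b ⁻¹) + β₁ * ((1# + - h) * (1# + - h) ⁻¹)
          ≡⟨ cong₂ (λ u w → (β₂ + - β₁) * u + β₁ * w) (⁻¹-inverse _ σb≢0) (⁻¹-inverse _ 1-h≢0) ⟩
        (β₂ + - β₁) * 1# + β₁ * 1#                          ≡⟨ solve 2 (λ β₁ β₂ → (β₂ :- β₁) :* con (ℤ.+ 1) :+ β₁ :* con (ℤ.+ 1) := β₂) refl β₁ β₂ ⟩
        β₂                                                  ∎

  module AutomorphismInvariants (A : Automorphism S) where
    open Automorphism A

    linear : Aff → Carrier
    linear u = proj₁ (φ u)

    linear≢0 : ∀ {u} → InG S u → linear u ≢ 0#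
    linear≢0 {u} u∈G = elems-nonzero (linear u) (φ-closed u u∈G)

    linear-homo : ∀ {u v} → InG S u → InG S v → linear (u · v) ≡ linear u * linear v
    linear-homo {u} {v} u∈G v∈G = cong proj₁ (φ-hom u v u∈G v∈G)

    φ-e : φ e ≡ e
    φ-e = idempotent⇒e {φ e} (φ-closed e one∈) (trans (sym (φ-hom e e one∈ one∈)) (cong φ e·e≡e))
      where
      e·e≡e : e · e ≡ e
      e·e≡e = cong₂ _,_ (*-identityˡ 1#) (trans (cong (_+ 0#) (zeroʳ 1#)) (+-identityʳ 0#))

    linear-^ᵍ : ∀ {u} → InG S u → ∀ k → linear (u ^ᵍ k) ≡ pow (linear u) k
    linear-^ᵍ u∈G zero    = cong proj₁ φ-e
    linear-^ᵍ {u} u∈G (suc k) = trans (linear-homo {u} {u ^ᵍ k} u∈G (^ᵍ-closed k u∈G)) (cong (linear u *_) (linear-^ᵍ u∈G k))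

    module _ {g} (g∈S : g ∈ elems) (g≢1 : g ≢ 1#) where

      -- Every translation (1, β) is the commutator of (g, 0) with (1, β / (g − 1)).
      linear-translation : ∀ β → linear (1# , β) ≡ 1#
      linear-translation β = sym (*-cancelˡ (linear≢0 {1# , γ} one∈) (begin
        linear (1# , γ) * 1#                  ≡⟨ *-identityʳ _ ⟩
        linear (1# , γ)                       ≡⟨ sym (conjugation-invariant γ) ⟩
        linear (1# , g * γ)                   ≡⟨ cong (λ δ → linear (1# , δ)) gγ≡β+γ ⟩
        linear (1# , β + γ)                   ≡⟨ cong linear (sym (translation-· γ β)) ⟩
        linear ((1# , γ) · (1# , β))          ≡⟨ linear-homo {1# , γ} {1# , β} one∈ one∈ ⟩
        linear (1# , γ) * linear (1# , β)     ∎))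
        where
        open ≡-Reasoning
        g-1≢0 : g + - 1# ≢ 0#
        g-1≢0 g-1≡0 = g≢1 (x-y≡0⇒x≡y g-1≡0)
        γ = β * (g + - 1#) ⁻¹
        gγ≡β+γ : g * γ ≡ β + γ
        gγ≡β+γ = begin
          g * (β * (g + - 1#) ⁻¹)                              ≡⟨ solve 3 (λ g β d⁻¹ → g :* (β :* d⁻¹) := β :* ((g :- con (ℤ.+ 1)) :* d⁻¹) :+ β :* d⁻¹) refl g β ((g + - 1#) ⁻¹) ⟩
          β * ((g + - 1#) * (g + - 1#) ⁻¹) + β * (g + - 1#) ⁻¹ ≡⟨ cong (λ t → β * t + γ) (⁻¹-inverse _ g-1≢0) ⟩
          β * 1# + γ                                           ≡⟨ cong (_+ γ) (*-identityʳ β) ⟩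
          β + γ                                                ∎
        conjugation-invariant : ∀ γ → linear (1# , g * γ) ≡ linear (1# , γ)
        conjugation-invariant γ = *-cancelˡ (linear≢0 {g , 0#} g∈S) (begin
          linear (g , 0#) * linear (1# , g * γ)     ≡⟨ *-comm _ _ ⟩
          linear (1# , g * γ) * linear (g , 0#)     ≡⟨ sym (linear-homo {1# , g * γ} {g , 0#} one∈ g∈S) ⟩
          linear ((1# , g * γ) · (g , 0#))          ≡⟨ cong linear (sym (diagonal-conjugates-translation g γ)) ⟩
          linear ((g , 0#) · (1# , γ))              ≡⟨ linear-homo {g , 0#} {1# , γ} g∈S one∈ ⟩
          linear (g , 0#) * linear (1# , γ)         ∎)

      linear-ignores-translation : ∀ {a} β → a ∈ elems → linear (a , β) ≡ linear (a , 0#)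
      linear-ignores-translation {a} β a∈S = begin
        linear (a , β)                         ≡⟨ cong linear (sym (translation-·-diagonal a β)) ⟩
        linear ((1# , β) · (a , 0#))           ≡⟨ linear-homo {1# , β} {a , 0#} one∈ a∈S ⟩
        linear (1# , β) * linear (a , 0#)      ≡⟨ cong (_* linear (a , 0#)) (linear-translation β) ⟩
        1# * linear (a , 0#)                   ≡⟨ *-identityˡ _ ⟩
        linear (a , 0#)                        ∎
        where open ≡-Reasoning

      τ : Carrier → Carrier
      τ β = proj₂ (φ (1# , β))

      τ-homo-+ : ∀ γ δ → τ (δ + γ) ≡ τ δ + τ γ
      τ-homo-+ γ δ = begin
        τ (δ + γ)                          ≡⟨ cong (λ u → proj₂ (φ u)) (sym (translation-· γ δ)) ⟩
        proj₂ (φ ((1# , γ) · (1# , δ)))    ≡⟨ cong proj₂ (φ-hom (1# , γ) (1# , δ) one∈ one∈) ⟩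
        linear (1# , γ) * τ δ + τ γ        ≡⟨ cong (λ t → t * τ δ + τ γ) (linear-translation γ) ⟩
        1# * τ δ + τ γ                     ≡⟨ cong (_+ τ γ) (*-identityˡ _) ⟩
        τ δ + τ γ                          ∎
        where open ≡-Reasoning

      τ-homo-0 : τ 0# ≡ 0#
      τ-homo-0 = sym (+-cancelˡ (τ 0#) 0# (τ 0#)
        (trans (+-identityʳ _) (trans (cong τ (sym (+-identityʳ 0#))) (τ-homo-+ 0# 0#))))

      τ-homo-fromℕ : ∀ k β → τ (fromℕ k * β) ≡ fromℕ k * τ β
      τ-homo-fromℕ zero    β = trans (cong τ (zeroˡ β)) (trans τ-homo-0 (sym (zeroˡ _)))
      τ-homo-fromℕ (suc k) β = begin
        τ (fromℕ (suc k) * β)        ≡⟨ cong τ (trans (cong (_* β) (fromℕ-suc k)) (distribʳ _ _ _)) ⟩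
        τ (1# * β + fromℕ k * β)     ≡⟨ cong (λ t → τ (t + fromℕ k * β)) (*-identityˡ β) ⟩
        τ (β + fromℕ k * β)          ≡⟨ τ-homo-+ (fromℕ k * β) β ⟩
        τ β + τ (fromℕ k * β)        ≡⟨ cong (τ β +_) (τ-homo-fromℕ k β) ⟩
        τ β + fromℕ k * τ β          ≡⟨ cong (_+ fromℕ k * τ β) (sym (*-identityˡ _)) ⟩
        1# * τ β + fromℕ k * τ β     ≡⟨ sym (distribʳ _ _ _) ⟩
        (1# + fromℕ k) * τ β         ≡⟨ cong (_* τ β) (sym (fromℕ-suc k)) ⟩
        fromℕ (suc k) * τ β          ∎
        where open ≡-Reasoning

      τ-injective : ∀ {β β′} → τ β ≡ τ β′ → β ≡ β′
      τ-injective {β} {β′} eq =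
        cong proj₂ (φ-inj (1# , β) (1# , β′) one∈ one∈ (cong₂ _,_ (trans (linear-translation β) (sym (linear-translation β′))) eq))

      τ-conjugation : ∀ γ → linear (g , 0#) * τ γ ≡ τ (g * γ)
      τ-conjugation γ = +-cancelʳ (proj₂ (φ (g , 0#))) _ _ (begin
        linear (g , 0#) * τ γ + proj₂ (φ (g , 0#))
          ≡⟨ cong proj₂ (trans (sym (φ-hom (g , 0#) (1# , γ) g∈S one∈))
                               (trans (cong φ (diagonal-conjugates-translation g γ)) (φ-hom (1# , g * γ) (g , 0#) one∈ g∈S))) ⟩
        linear (1# , g * γ) * proj₂ (φ (g , 0#)) + τ (g * γ)
          ≡⟨ cong (λ t → t * proj₂ (φ (g , 0#)) + τ (g * γ)) (linear-translation (g * γ)) ⟩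
        1# * proj₂ (φ (g , 0#)) + τ (g * γ)    ≡⟨ cong (_+ τ (g * γ)) (*-identityˡ _) ⟩
        proj₂ (φ (g , 0#)) + τ (g * γ)         ≡⟨ +-comm _ _ ⟩
        τ (g * γ) + proj₂ (φ (g , 0#))         ∎)
        where open ≡-Reasoning

      -- Over the prime field g is a multiple of 1#, which the additive map τ commutes with.
      linear-diagonal-over-prime-field : ∀ {p} → Prime p → size ≡ p → linear (g , 0#) ≡ g
      linear-diagonal-over-prime-field {p} p-prime size≡p with PrimeCharacteristic.prime-field p-prime p≡0 size≡p g
        where
        p≡0 : fromℕ p ≡ 0#
        p≡0 = trans (cong fromℕ (sym size≡p)) fromℕ-size≡0
      ... | k , k≡g = *-cancelˡ τ1≢0 (begin
        τ 1# * linear (g , 0#)    ≡⟨ *-comm _ _ ⟩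
        linear (g , 0#) * τ 1#    ≡⟨ τ-conjugation 1# ⟩
        τ (g * 1#)                ≡⟨ cong (λ t → τ (t * 1#)) (sym k≡g) ⟩
        τ (fromℕ k * 1#)          ≡⟨ τ-homo-fromℕ k 1# ⟩
        fromℕ k * τ 1#            ≡⟨ cong (_* τ 1#) k≡g ⟩
        g * τ 1#                  ≡⟨ *-comm _ _ ⟩
        τ 1# * g                  ∎)
        where
        open ≡-Reasoning
        τ1≢0 : τ 1# ≢ 0#
        τ1≢0 eq = 1≢0 (τ-injective (trans eq (sym τ-homo-0)))

module PaleyDessin {F : FiniteField} {n : ℕ} (S : MultSubgroup F n)
  (g : FiniteField.Carrier F) (g∈S : g ∈ MultSubgroup.elems S)
  (generates : ∀ a → a ∈ MultSubgroup.elems S → Σ ℕ λ k → a ≡ FiniteField.pow F g k)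
  (b : FiniteField.Carrier F) (b≢0 : b ≢ FiniteField.0# F) where
  open FieldProperties F
  open AGL F
  open MultSubgroup S
  open AffineGroup F S
  open CyclicSubgroup S g g∈S generates

  x : Aff
  x = (g , 0#)

  g≢1 : 1 ℕ.< n → g ≢ 1#
  g≢1 1<n g≡1 = ℕ.<⇒≱ 1<n (order≤ 0 (trans (*-identityʳ g) g≡1))

  module Forward {c : ℕ} (c<n : c ℕ.< n) where
    y : Aff
    y = (pow g c , b)

    D : Pair
    D = (x , y)

    module _ (1<n : 1 ℕ.< n) (A : Automorphism S) where
      open Automorphism A
      open AutomorphismInvariants A

      linear-y : linear y ≡ pow (linear x) c
      linear-y = begin
        linear (pow g c , b)    ≡⟨ linear-ignores-translation g∈S (g≢1 1<n) b (pow∈S c g∈S) ⟩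
        linear (pow g c , 0#)   ≡⟨ cong linear (sym (diagonal-^ᵍ g c)) ⟩
        linear (x ^ᵍ c)         ≡⟨ linear-^ᵍ {x} g∈S c ⟩
        pow (linear x) c        ∎
        where open ≡-Reasoning

    -- Every automorphism fixes e, and x = e when n = 1.
    swap⇒1<n : IsoDessin S D (applyΩ D01 D) → 1 ℕ.< n
    swap⇒1<n (A , x↦y , _) with n ℕ.≟ 1
    ... | no  n≢1 = ℕ.≤∧≢⇒< 1≤n (λ 1≡n → n≢1 (sym 1≡n))
    ... | yes n≡1 = ⊥-elim (b≢0 (cong proj₂ (begin
      y        ≡⟨ sym x↦y ⟩
      φ x      ≡⟨ cong φ x≡e ⟩
      φ e      ≡⟨ AutomorphismInvariants.φ-e A ⟩
      e        ∎)))
      where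
      open ≡-Reasoning
      open Automorphism A
      x≡e : x ≡ e
      x≡e = cong (_, 0#) (trans (sym (*-identityʳ g)) (subst (λ m → pow g m ≡ 1#) n≡1 pow-order≡1))

    D12⇒order∣2c+1 : 1 ℕ.< n → IsoDessin S D (applyΩ D12 D) → n ∣ suc (c ℕ.+ c)
    D12⇒order∣2c+1 1<n (A , x↦x , y↦z) = pow≡1⇒order∣ (suc (c ℕ.+ c)) (begin
      g * pow g (c ℕ.+ c)              ≡⟨ cong (g *_) (pow-homo-+ g c c) ⟩
      g * (pow g c * pow g c)          ≡⟨ sym (*-assoc _ _ _) ⟩
      g * pow g c * pow g c            ≡⟨ cong (g * pow g c *_) gᶜ≡[g·gᶜ]⁻¹ ⟩
      g * pow g c * (g * pow g c) ⁻¹   ≡⟨ ⁻¹-inverse _ (*≢0 g≢0 (pow≢0 c g≢0)) ⟩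
      1#                               ∎)
      where
      open ≡-Reasoning
      open AutomorphismInvariants A
      gᶜ≡[g·gᶜ]⁻¹ : pow g c ≡ (g * pow g c) ⁻¹
      gᶜ≡[g·gᶜ]⁻¹ = trans (sym (trans (linear-y 1<n A) (cong (λ t → pow t c) (cong proj₁ x↦x)))) (cong proj₁ y↦z)

    D01⇒order∣c²-1 : 1 ℕ.< n → IsoDessin S D (applyΩ D01 D) → n ∣ ℕ.∣ c ℕ.* c - 1 ∣
    D01⇒order∣c²-1 1<n (A , x↦y , y↦x) = pow≡pow⇒order∣ (c ℕ.* c) 1 (begin
      pow g (c ℕ.* c)          ≡⟨ pow-assoc g c c ⟩
      pow (pow g c) c          ≡⟨ cong (λ t → pow t c) (sym (cong proj₁ x↦y)) ⟩
      pow (linear x) c         ≡⟨ sym (linear-y 1<n A) ⟩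
      linear y                 ≡⟨ cong proj₁ y↦x ⟩
      g                        ≡⟨ sym (*-identityʳ g) ⟩
      pow g 1                  ∎)
      where
      open ≡-Reasoning
      open AutomorphismInvariants A

    hole-over-prime-field : ∀ {p j} → Prime p → size ≡ p → 1 ℕ.< n → IsoDessin S D (Hraw j D) → pow g j ≡ g
    hole-over-prime-field {j = j} p-prime size≡p 1<n (A , x↦xʲ , _) = begin
      pow g j                  ≡⟨ sym (cong proj₁ (trans x↦xʲ (diagonal-^ᵍ g j))) ⟩
      linear x                 ≡⟨ linear-diagonal-over-prime-field g∈S (g≢1 1<n) p-prime size≡p ⟩
      g                        ∎
      where
      open ≡-Reasoning
      open AutomorphismInvariants A

    kaleidoscopic⇒ : ∀ {p d} → Prime p → size ≡ p ℕ.^ d → ValencyCond n p d →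
                     Kaleidoscopic S c D → n ≡ 3 × p % 3 ≡ 2 × c ≡ 1
    kaleidoscopic⇒ {p} {d} p-prime size≡pᵈ valency (Ω*-invariant , hole-invariant) = n≡3 , p%3≡2 valency , c≡1
      where
      1<n : 1 ℕ.< n
      1<n = swap⇒1<n (Ω*-invariant (D01 , false))
      n≡3×c≡1 : n ≡ 3 × c ≡ 1
      n≡3×c≡1 = valency-three 1<n c<n (D12⇒order∣2c+1 1<n (Ω*-invariant (D12 , false)))
                                      (D01⇒order∣c²-1 1<n (Ω*-invariant (D01 , false)))
      n≡3 = proj₁ n≡3×c≡1
      c≡1 = proj₂ n≡3×c≡1
      H₂-invariant : IsoDessin S D (Hraw 2 D)
      H₂-invariant = subst (λ k → IsoDessin S D (holeOp 2 k D)) c≡1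
                           (hole-invariant 2 (subst (Coprime 2) (sym n≡3) (from-yes (coprime? 2 3))))
      prime-field-excluded : d ≢ 1
      prime-field-excluded d≡1 = g≢1 1<n (trans (sym (*-identityʳ g)) (*-cancelˡ g≢0 g·g≡g))
        where
        g·g≡g : g * (g * 1#) ≡ g * 1#
        g·g≡g = trans (hole-over-prime-field {j = 2} p-prime (trans size≡pᵈ (trans (cong (p ℕ.^_) d≡1) (ℕ.*-identityʳ p))) 1<n H₂-invariant)
                      (sym (*-identityʳ g))
      p%3≡2 : ValencyCond n p d → p % 3 ≡ 2
      p%3≡2 (inj₁ (n≡1 , _))     = ⊥-elim (ℕ.<⇒≢ 1<n (sym n≡1))
      p%3≡2 (inj₂ (_ , p-order)) with multOrder-mod-3 {{prime⇒nonZero p-prime}} (subst (λ m → MultOrder p m d) n≡3 p-order)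
      ... | inj₁ d≡1   = ⊥-elim (prime-field-excluded d≡1)
      ... | inj₂ p%3≡2 = p%3≡2

  module Backward {p d : ℕ} (p-prime : Prime p) (1≤d : 1 ℕ.≤ d) (size≡pᵈ : size ≡ p ℕ.^ d)
                  (n≡3 : n ≡ 3) (p%3≡2 : p % 3 ≡ 2) where
    y : Aff
    y = (g , b)

    D : Pair
    D = (x , y)

    1<n : 1 ℕ.< n
    1<n = subst (1 ℕ.<_) (sym n≡3) (ℕ.s≤s (ℕ.s≤s ℕ.z≤n))

    g³≡1 : g * (g * g) ≡ 1#
    g³≡1 = trans (cong (λ t → g * (g * t)) (sym (*-identityʳ g))) (subst (λ m → pow g m ≡ 1#) n≡3 pow-order≡1)

    g⁻¹≡g² : g ⁻¹ ≡ g * g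
    g⁻¹≡g² = ⁻¹-unique g³≡1

    [g²]⁻¹≡g : (g * g) ⁻¹ ≡ g
    [g²]⁻¹≡g = ⁻¹-unique (trans (*-comm _ _) g³≡1)

    -- g is a root of x³ − 1 = (x − 1)(x² + x + 1) other than 1.
    1+g+g²≡0 : 1# + g + g * g ≡ 0#
    1+g+g²≡0 with *≡0⇒≡0 (trans (solve 1 (λ g → (g :- con (ℤ.+ 1)) :* (con (ℤ.+ 1) :+ g :+ g :* g) := g :* (g :* g) :- con (ℤ.+ 1)) refl g)
                               (trans (cong (_+ - 1#) g³≡1) (-‿inverseʳ 1#)))
    ... | inj₁ g-1≡0    = ⊥-elim (g≢1 1<n (x-y≡0⇒x≡y g-1≡0))
    ... | inj₂ 1+g+g²≡0 = 1+g+g²≡0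

    frob : FieldAutomorphism
    frob = frobenius p-prime (characteristic p d 1≤d size≡pᵈ)
    open FieldAutomorphism frob using (σ; σ-injective; σ-homo-*; σ-homo-pow)

    σg≡g² : σ g ≡ g * g
    σg≡g² = begin
      pow g p              ≡⟨ pow-mod 3 (subst (λ m → pow g m ≡ 1#) n≡3 pow-order≡1) p ⟩
      pow g (p % 3)        ≡⟨ cong (pow g) p%3≡2 ⟩
      g * (g * 1#)         ≡⟨ cong (g *_) (*-identityʳ g) ⟩
      g * g                ∎
      where open ≡-Reasoning

    σ-preserves-S : ∀ a → a ∈ elems → σ a ∈ elems
    σ-preserves-S a = pow∈S p

    -- Every element of S is σ of a power of g², since σ (g²) = g⁴ = g.
    σ-reflects-S : ∀ a → σ a ∈ elems → a ∈ elems
    σ-reflects-S a σa∈S with generates (σ a) σa∈S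
    ... | k , σa≡gᵏ = subst (_∈ elems) (σ-injective (trans σ[g²ᵏ]≡gᵏ (sym σa≡gᵏ))) (pow∈S k (mul∈ g g g∈S g∈S))
      where
      σg²≡g : σ (g * g) ≡ g
      σg²≡g = begin
        σ (g * g)              ≡⟨ trans (σ-homo-* g g) (cong₂ _*_ σg≡g² σg≡g²) ⟩
        g * g * (g * g)        ≡⟨ solve 1 (λ g → g :* g :* (g :* g) := g :* (g :* (g :* g))) refl g ⟩
        g * (g * (g * g))      ≡⟨ cong (g *_) g³≡1 ⟩
        g * 1#                 ≡⟨ *-identityʳ g ⟩
        g                      ∎
        where open ≡-Reasoning
      σ[g²ᵏ]≡gᵏ : σ (pow (g * g) k) ≡ pow g k
      σ[g²ᵏ]≡gᵏ = trans (σ-homo-pow (g * g) k) (cong (λ t → pow t k) σg²≡g)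

    iso-fixing-g : ∀ {a₁ a₂ β₁ β₂} → a₁ ≡ g → a₂ ≡ g → β₁ ≢ β₂ → IsoDessin S D ((a₁ , β₁) , (a₂ , β₂))
    iso-fixing-g = affine-isomorphism identityAutomorphism (λ _ a∈S → a∈S) (λ _ a∈S → a∈S) (g≢1 1<n) b≢0 refl

    iso-squaring-g : ∀ {a₁ a₂ β₁ β₂} → a₁ ≡ g * g → a₂ ≡ g * g → β₁ ≢ β₂ → IsoDessin S D ((a₁ , β₁) , (a₂ , β₂))
    iso-squaring-g = affine-isomorphism frob σ-preserves-S σ-reflects-S (g≢1 1<n) b≢0 σg≡g²

    [g²]⁻¹⁻¹≡g² : ((g * g) ⁻¹) ⁻¹ ≡ g * g
    [g²]⁻¹⁻¹≡g² = trans (cong _⁻¹ [g²]⁻¹≡g) g⁻¹≡g²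

    g⁻¹≡[g²]⁻¹⁻¹ : g ⁻¹ ≡ ((g * g) ⁻¹) ⁻¹
    g⁻¹≡[g²]⁻¹⁻¹ = trans g⁻¹≡g² (sym [g²]⁻¹⁻¹≡g²)

    g⁻¹≢0 : g ⁻¹ ≢ 0#
    g⁻¹≢0 = ⁻¹≢0 g≢0

    [g²]⁻¹⁻¹≢0 : ((g * g) ⁻¹) ⁻¹ ≢ 0#
    [g²]⁻¹⁻¹≢0 = ⁻¹≢0 (⁻¹≢0 (*≢0 g≢0 g≢0))

    zβ : Carrier
    zβ = - ((g * g) ⁻¹ * (g * b + 0#))

    0≢b : 0# ≢ b
    0≢b 0≡b = b≢0 (sym 0≡b)

    0≢zβ : 0# ≢ zβ
    0≢zβ 0≡zβ with *≡0⇒≡0 (trans (sym (-‿involutive _)) (trans (cong -_ (sym 0≡zβ)) -0#≈0#))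
    ... | inj₁ [g²]⁻¹≡0 = ⁻¹≢0 (*≢0 g≢0 g≢0) [g²]⁻¹≡0
    ... | inj₂ gb+0≡0   = *≢0 g≢0 b≢0 (trans (sym (+-identityʳ _)) gb+0≡0)

    -- zβ = −g²b, and b + g²b = −gb ≠ 0.
    b≢zβ : b ≢ zβ
    b≢zβ b≡zβ = *≢0 g≢0 b≢0 (begin
      g * b                                           ≡⟨ solve 2 (λ g b → g :* b := (con (ℤ.+ 1) :+ g :+ g :* g) :* b :- (b :- :- (g :* (g :* b :+ con (ℤ.+ 0))))) refl g b ⟩
      (1# + g + g * g) * b + - (b + - - (g * (g * b + 0#))) ≡⟨ cong₂ (λ u w → u * b + - (b + - - (w * (g * b + 0#)))) 1+g+g²≡0 (sym [g²]⁻¹≡g) ⟩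
      0# * b + - (b + - zβ)                           ≡⟨ cong (λ t → 0# * b + - (b + - t)) (sym b≡zβ) ⟩
      0# * b + - (b + - b)                            ≡⟨ solve 1 (λ b → con (ℤ.+ 0) :* b :- (b :- b) := con (ℤ.+ 0)) refl b ⟩
      0#                                              ∎)
      where open ≡-Reasoning

    negated-scalings-differ : ∀ {a a′ β β′} → a ≡ a′ → a ≢ 0# → β ≢ β′ → - (a * β) ≢ - (a′ * β′)
    negated-scalings-differ refl a≢0 β≢β′ eq = β≢β′ (*-cancelˡ a≢0 (-‿injective eq))

    Ω*-invariant : ∀ ω → IsoDessin S D (applyΩ* ω D)
    Ω*-invariant (Id   , false) = iso-fixing-g refl refl 0≢b
    Ω*-invariant (D01  , false) = iso-fixing-g refl refl b≢0
    Ω*-invariant (D12  , false) = iso-fixing-g refl [g²]⁻¹≡g 0≢zβ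
    Ω*-invariant (D02  , false) = iso-fixing-g [g²]⁻¹≡g refl (λ zβ≡b → b≢zβ (sym zβ≡b))
    Ω*-invariant (D012 , false) = iso-fixing-g refl [g²]⁻¹≡g b≢zβ
    Ω*-invariant (D210 , false) = iso-fixing-g [g²]⁻¹≡g refl (λ zβ≡0 → 0≢zβ (sym zβ≡0))
    Ω*-invariant (Id   , true)  = iso-squaring-g g⁻¹≡g² g⁻¹≡g² (negated-scalings-differ refl g⁻¹≢0 0≢b)
    Ω*-invariant (D01  , true)  = iso-squaring-g g⁻¹≡g² g⁻¹≡g² (negated-scalings-differ refl g⁻¹≢0 b≢0)
    Ω*-invariant (D12  , true)  = iso-squaring-g g⁻¹≡g² [g²]⁻¹⁻¹≡g² (negated-scalings-differ g⁻¹≡[g²]⁻¹⁻¹ g⁻¹≢0 0≢zβ)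
    Ω*-invariant (D02  , true)  = iso-squaring-g [g²]⁻¹⁻¹≡g² g⁻¹≡g² (negated-scalings-differ (sym g⁻¹≡[g²]⁻¹⁻¹) [g²]⁻¹⁻¹≢0 (λ zβ≡b → b≢zβ (sym zβ≡b)))
    Ω*-invariant (D012 , true)  = iso-squaring-g g⁻¹≡g² [g²]⁻¹⁻¹≡g² (negated-scalings-differ g⁻¹≡[g²]⁻¹⁻¹ g⁻¹≢0 b≢zβ)
    Ω*-invariant (D210 , true)  = iso-squaring-g [g²]⁻¹⁻¹≡g² g⁻¹≡g² (negated-scalings-differ (sym g⁻¹≡[g²]⁻¹⁻¹) [g²]⁻¹⁻¹≢0 (λ zβ≡0 → 0≢zβ (sym zβ≡0)))

    geometric : ℕ → Carrier
    geometric zero    = 0#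
    geometric (suc k) = g * geometric k + 1#

    ^ᵍ-affine : ∀ β k → (g , β) ^ᵍ k ≡ (pow g k , geometric k * β)
    ^ᵍ-affine β zero    = cong (1# ,_) (sym (zeroˡ β))
    ^ᵍ-affine β (suc k) = trans (cong ((g , β) ·_) (^ᵍ-affine β k))
      (cong (g * pow g k ,_) (solve 3 (λ g G β → g :* (G :* β) :+ β := (g :* G :+ con (ℤ.+ 1)) :* β) refl g (geometric k) β))

    geometric-mod : ∀ j → geometric j ≡ geometric (j % 3)
    geometric-mod j = trans (cong geometric (trans (m≡m%n+[m/n]*n j 3) (ℕ.+-comm (j % 3) _))) (period (j / 3) (j % 3))
      where
      period : ∀ q r → geometric (q ℕ.* 3 ℕ.+ r) ≡ geometric r
      period zero    r = refl
      period (suc q) r = begin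
        geometric (3 ℕ.+ (q ℕ.* 3 ℕ.+ r))                        ≡⟨ solve 2 (λ g G → g :* (g :* (g :* G :+ con (ℤ.+ 1)) :+ con (ℤ.+ 1)) :+ con (ℤ.+ 1)
                                                                                  := g :* (g :* g) :* G :+ (con (ℤ.+ 1) :+ g :+ g :* g)) refl g _ ⟩
        g * (g * g) * geometric (q ℕ.* 3 ℕ.+ r) + (1# + g + g * g) ≡⟨ cong₂ (λ u w → u * geometric (q ℕ.* 3 ℕ.+ r) + w) g³≡1 1+g+g²≡0 ⟩
        1# * geometric (q ℕ.* 3 ℕ.+ r) + 0#                      ≡⟨ trans (+-identityʳ _) (*-identityˡ _) ⟩
        geometric (q ℕ.* 3 ℕ.+ r)                                ≡⟨ period q r ⟩
        geometric r                                              ∎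
        where open ≡-Reasoning

    hole-invariant : ∀ j → Coprime j n → IsoDessin S D (Hraw j D)
    hole-invariant j j⊥n = subst (IsoDessin S D) (sym (cong₂ _,_ (^ᵍ-affine 0# j) (^ᵍ-affine b j))) (by-residue (j % 3) refl)
      where
      gʲ≡ : pow g j ≡ pow g (j % 3)
      gʲ≡ = pow-mod 3 (subst (λ m → pow g m ≡ 1#) n≡3 pow-order≡1) j
      scalings-differ : ∀ {k} → k ≢ 0# → k * 0# ≢ k * b
      scalings-differ k≢0 eq = 0≢b (*-cancelˡ k≢0 eq)
      by-residue : ∀ r → j % 3 ≡ r → IsoDessin S D ((pow g j , geometric j * 0#) , (pow g j , geometric j * b))
      by-residue 0 j%3≡0 = ⊥-elim (coprime-3⇒%3≢0 j (subst (Coprime j) n≡3 j⊥n) j%3≡0)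
      by-residue 1 j%3≡1 = iso-fixing-g gʲ≡g gʲ≡g (scalings-differ geometric-j≢0)
        where
        gʲ≡g : pow g j ≡ g
        gʲ≡g = trans gʲ≡ (trans (cong (pow g) j%3≡1) (*-identityʳ g))
        geometric-j≢0 : geometric j ≢ 0#
        geometric-j≢0 eq = 1≢0 (trans (sym (trans (cong (_+ 1#) (zeroʳ g)) (+-identityˡ 1#))) (trans (cong geometric (sym j%3≡1)) (trans (sym (geometric-mod j)) eq)))
      by-residue 2 j%3≡2 = iso-squaring-g gʲ≡g² gʲ≡g² (scalings-differ geometric-j≢0)
        where
        gʲ≡g² : pow g j ≡ g * g
        gʲ≡g² = trans gʲ≡ (trans (cong (pow g) j%3≡2) (cong (g *_) (*-identityʳ g)))
        -- geometric 2 = g + 1 = −g².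
        geometric-j≢0 : geometric j ≢ 0#
        geometric-j≢0 eq = *≢0 g≢0 g≢0 (begin
          g * g                                         ≡⟨ solve 1 (λ g → g :* g := con (ℤ.+ 1) :+ g :+ g :* g :- (g :* (g :* con (ℤ.+ 0) :+ con (ℤ.+ 1)) :+ con (ℤ.+ 1))) refl g ⟩
          1# + g + g * g + - geometric 2                ≡⟨ cong₂ (λ u w → u + - w) 1+g+g²≡0 (trans (cong geometric (sym j%3≡2)) (trans (sym (geometric-mod j)) eq)) ⟩
          0# + - 0#                                     ≡⟨ trans (+-identityˡ _) -0#≈0# ⟩
          0#                                            ∎)
          where open ≡-Reasoning
      by-residue (suc (suc (suc r))) j%3≡r = ⊥-elim (ℕ.<⇒≱ (subst (ℕ._< 3) j%3≡r (m%n<n j 3)) (ℕ.s≤s (ℕ.s≤s (ℕ.s≤s ℕ.z≤n))))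

    kaleidoscopic : Kaleidoscopic S 1 D
    kaleidoscopic = Ω*-invariant , hole-invariant

corollary5p7 : (p d : ℕ) → Prime p → 1 ≤ d →
    (F : FiniteField) → FiniteField.size F ≡ p ^ d →
    (n : ℕ) → ValencyCond n p d → (S : MultSubgroup F n) →
    (g : FiniteField.Carrier F) → g ∈ MultSubgroup.elems S →
    (∀ a → a ∈ MultSubgroup.elems S → Σ ℕ λ k → a ≡ FiniteField.pow F g k) →
    (y : AGL.Aff F) → AGL.InG F S y → ¬ AGL.InS F S y →
    (c : Fin n) →
    Σ (FiniteField.Carrier F) (λ b → y ≡ AGL._·_ F (FiniteField.1# F , b) (AGL._^ᵍ_ F (g , FiniteField.0# F) (toℕ c))) →
    AGL.Kaleidoscopic F S (toℕ c) ((g , FiniteField.0# F) , y)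
      ⇔ ((n ≡ 3) × (p % 3 ≡ 2) × (toℕ c ≡ 1))
corollary5p7 p d p-prime 1≤d F size≡pᵈ n valency S g g∈S generates y _ y∉S c (b , y≡[1,b]·xᶜ) =
  mk⇔ (Forward.kaleidoscopic⇒ (Fin.toℕ<n c) p-prime size≡pᵈ valency ∘ subst (Kaleidoscopic S (toℕ c) ∘ (x ,_)) y≡gᶜ,b)
      (λ { (n≡3 , p%3≡2 , c≡1) → subst₂ (λ k u → Kaleidoscopic S k (x , u)) (sym c≡1) (sym (y≡g,b c≡1))
                                        (Backward.kaleidoscopic p-prime 1≤d size≡pᵈ n≡3 p%3≡2) })
  where
  open FieldProperties F
  open AGL F
  open AffineGroup F S
  y≡gᶜ,b : y ≡ (pow g (toℕ c) , b)
  y≡gᶜ,b = trans y≡[1,b]·xᶜ (trans (cong ((1# , b) ·_) (diagonal-^ᵍ g (toℕ c))) (translation-·-diagonal (pow g (toℕ c)) b))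
  b≢0 : b ≢ 0#
  b≢0 b≡0 = y∉S (pow g (toℕ c) , CyclicSubgroup.pow∈S S g g∈S generates (toℕ c) g∈S , trans y≡gᶜ,b (cong (pow g (toℕ c) ,_) b≡0))
  open PaleyDessin S g g∈S generates b b≢0
  y≡g,b : toℕ c ≡ 1 → y ≡ (g , b)
  y≡g,b c≡1 = trans y≡gᶜ,b (cong (_, b) (trans (cong (pow g) c≡1) (*-identityʳ g)))
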